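{- For any odd prime $p$ and integers $n,d\ge 1$ with $n\ge 2d$, \[ \delta_{n,p}(d) \le \frac{1}{p^d}\left(\left(\frac{p}{p-1}\right)^d - 1\right)^{\lfloor n/(2d)\rfloor}. \] In particular, if $d\le 4$ and $n\ge 16$, then $\delta_{n,p}(d)\ll p^{ -(d+2)}$ with an absolute implied constant.
   Context: $\mathbb{F}_p[x]_m$ is the set of monic polynomials in $\mathbb{F}_p[x]$. For $u\in\mathbb{F}_p[x]_m$ and $\alpha\in\mathbb{F}_p[x]/(u)$, $\mathcal{A}_n(u;\alpha) = \{(a_1,\ldots,a_n)\in(\mathbb{F}_p\setminus\{0\})^n : a_1x^{n-1}+\cdots+a_n\equiv\alpha\bmod u\}$, and $\delta_{n,p}(d) = \max_{u\in\mathbb{F}_p[x]_m,\ \deg u=d,\ x\nmid u}\ \max_{\alpha\in\mathbb{F}_p[x]/(u)}\left|\frac{|\mathcal{A}_n(u;\alpha)|}{(p-1)^n} - p^{ -d}\right|$. -}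

module Defs where

open import Data.Nat as ℕ using (ℕ; zero; suc; NonZero; _∸_)
open import Data.Nat.DivMod using (_mod_; _/_)
open import Data.Fin as Fin using (Fin; toℕ)
open import Data.Vec as Vec using (Vec; []; _∷_)
open import Data.Vec.Properties using (≡-dec)
open import Data.Vec.Relation.Unary.All as All using (All)
open import Data.List as List using (List; length; filter; concatMap; allFin)
open import Data.Product using (_×_)
open import Data.Unit using (⊤)
open import Data.Integer as ℤ using (+_)
open import Data.Rational as ℚ using (ℚ; 0ℚ; 1ℚ; _*_)
open import Relation.Nullary using (¬_; ¬?)
open import Relation.Nullary.Decidable using (_×-dec_)
open import Relation.Binary.PropositionalEquality using (_≡_; _≢_)

module Field (p : ℕ) .{{_ : NonZero p}} where

  F : Set
  F = Fin p

  0F : F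
  0F = 0 mod p

  _+F_ : F → F → F
  a +F b = (toℕ a ℕ.+ toℕ b) mod p

  _*F_ : F → F → F
  a *F b = (toℕ a ℕ.* toℕ b) mod p

  -F_ : F → F
  -F a = (p ∸ toℕ a) mod p

  _-F_ : F → F → F
  a -F b = a +F (-F b)

  -- A monic u of degree d is encoded by its lower coefficients
  --   c = (c_0, …, c_{d-1}),  u = x^d + c_{d-1} x^{d-1} + … + c_0.
  -- An element of 𝔽_p[x]/(u) is encoded by its unique representative of
  -- degree < d, i.e. its coefficient vector (r_0, …, r_{d-1}).

  -- x ∤ u  ⇔  constant coefficient of u is nonzero (u = 1 when d = 0).
  XNotDivides : ∀ {d} → Vec F d → Set
  XNotDivides []      = ⊤
  XNotDivides (c ∷ _) = c ≢ 0F

  -- multiplication by x in 𝔽_p[x]/(u), using x^d ≡ -(c_0 + … + c_{d-1}x^{d-1})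
  mulX : ∀ {d} → Vec F d → Vec F d → Vec F d
  mulX {zero}  c r = []
  mulX {suc d} c r =
    Vec.zipWith (λ s cj → s -F (Vec.last r *F cj)) (0F ∷ Vec.init r) c

  addConst : ∀ {d} → F → Vec F d → Vec F d
  addConst a []      = []
  addConst a (r ∷ rs) = (r +F a) ∷ rs

  step : ∀ {d} → Vec F d → Vec F d → F → Vec F d
  step c r a = addConst a (mulX c r)

  -- reduce c (a_1,…,a_n) = a_1 x^{n-1} + … + a_n  mod u
  reduce : ∀ {d n} → Vec F d → Vec F n → Vec F d
  reduce c as = List.foldl (step c) (Vec.replicate _ 0F) (Vec.toList as)

  allVecs : (n : ℕ) → List (Vec F n)
  allVecs zero    = [] List.∷ List.[]
  allVecs (suc n) = concatMap (λ a → List.map (a ∷_) (allVecs n)) (allFin p)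

  InA : ∀ {d n} → Vec F d → Vec F d → Vec F n → Set
  InA c α as = All (λ a → a ≢ 0F) as × reduce c as ≡ α

  countA : ∀ {d} (n : ℕ) → Vec F d → Vec F d → ℕ
  countA n c α = length (filter
    (λ as → All.all? (λ a → ¬? (a Fin.≟ 0F)) as ×-dec ≡-dec Fin._≟_ (reduce c as) α)
    (allVecs n))

-- a / b as a rational (b = 0 is never used below; it is sent to 0)
frac : ℕ → ℕ → ℚ
frac a zero    = 0ℚ
frac a (suc b) = (+ a) ℚ./ suc b

powQ : ℚ → ℕ → ℚ
powQ q zero    = 1ℚ
powQ q (suc k) = q * powQ q k

-- ⌊ n / (2d) ⌋ for d ≥ 1 (value 0 for d = 0, never used)
floorDiv2d : ℕ → ℕ → ℕ
floorDiv2d n zero    = 0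
floorDiv2d n (suc k) = n / (2 ℕ.* suc k)

discrepancy : (p : ℕ) .{{_ : NonZero p}} (n : ℕ) {d : ℕ} →
              Vec (Fin p) d → Vec (Fin p) d → ℚ
discrepancy p n {d} c α =
  ℚ.∣ frac (Field.countA p n c α) ((p ∸ 1) ℕ.^ n) ℚ.- frac 1 (p ℕ.^ d) ∣

bound : ℕ → ℕ → ℕ → ℚ
bound p n d = frac 1 (p ℕ.^ d) * powQ (powQ (frac p (p ∸ 1)) d ℚ.- 1ℚ) (floorDiv2d n d)

{-# OPTIONS --safe #-}
module Submission where

-- Let D = deg u, Q = p^D, R = (p-1)^D and E = Q - R.  Residues mod u are coefficient
-- vectors in 𝔽_p^D, and a₁xⁿ⁻¹ + … + aₙ mod u is computed by Horner's rule
-- r ↦ x·r + a, so |𝒜_n(u;α)| counts walks of length n from 0 to α whose steps are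
-- these maps with a ≠ 0.  Since x ∤ u, multiplication by x is invertible mod u, so
-- every step is a bijection and the walk-count matrix has all row and column sums
-- (p-1)ⁿ.  Since D steps of Horner's rule never reduce mod u, the D-step matrix W has
-- 0/1 entries.  Applying Cauchy–Schwarz to the centred rows and columns of W bounds
-- the entries of K = W·W by |Q·K(z,α) - R²| ≤ R·E, and averaging against K shows
-- that every further 2D steps multiply the relative error by E/R.  Hence
-- δ ≤ Q⁻¹ (E/R)^⌊n/2D⌋, which is the first bound.  For the second, two periods and
-- p·E ≤ D·Q ≤ D·2^D·R give δ ≤ (D·2^D)² p^{-(D+2)} ≤ 4096 p^{-(D+2)} when D ≤ 4.

open import Data.Nat.Base using (ℕ; NonZero; suc)
open import Data.Nat.Primality using (Prime)
open import Data.Fin.Base using (Fin)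
open import Data.Vec.Base using (Vec)
open import Defs

module AbsoluteBound where

  import Data.Nat.Base as ℕ
  open import Data.Integer.Base
    using (ℤ; +_; -[1+_]; _+_; _*_; -_; _-_; _≤_; +≤+; -≤+; ∣_∣; nonNegative)
  import Data.Integer.Properties as ℤ
  open import Data.Integer.Tactic.RingSolver using (solve)
  open import Data.List.Base using (_∷_; [])
  open import Relation.Binary.PropositionalEquality using (_≡_; refl; sym; trans; cong; subst)

  infix 4 ∣_∣≤_
  record ∣_∣≤_ (x y : ℤ) : Set where
    constructor bounds
    field
      upper : x ≤ y
      lower : - x ≤ y

  ∣∣≤⇒+∣∣≤ : ∀ {x y} → ∣ x ∣≤ y → + ∣ x ∣ ≤ y
  ∣∣≤⇒+∣∣≤ {+ _}       (bounds x≤y _)   = x≤y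
  ∣∣≤⇒+∣∣≤ { -[1+ _ ]} (bounds _ -x≤y) = -x≤y

  +∣∣≤⇒∣∣≤ : ∀ {x y} → + ∣ x ∣ ≤ y → ∣ x ∣≤ y
  +∣∣≤⇒∣∣≤ {+ _}       h = bounds h (ℤ.≤-trans ℤ.neg-≤-pos h)
  +∣∣≤⇒∣∣≤ { -[1+ _ ]} h = bounds (ℤ.≤-trans -≤+ h) h

  ∣∣≤-nonNeg : ∀ {x y} → ∣ x ∣≤ y → + 0 ≤ y
  ∣∣≤-nonNeg h = ℤ.≤-trans (+≤+ ℕ.z≤n) (∣∣≤⇒+∣∣≤ h)

  *-monoˡ-∣∣≤ : ∀ {k x y} → + 0 ≤ k → ∣ x ∣≤ y → ∣ k * x ∣≤ k * y
  *-monoˡ-∣∣≤ {k} {x} 0≤k (bounds x≤y -x≤y) = bounds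
    (ℤ.*-monoˡ-≤-nonNeg k {{nonNegative 0≤k}} x≤y)
    (subst (_≤ k * _) (sym (ℤ.neg-distribʳ-* k x)) (ℤ.*-monoˡ-≤-nonNeg k {{nonNegative 0≤k}} -x≤y))

  *-cancelˡ-∣∣≤ : ∀ k .{{_ : ℕ.NonZero k}} {x y} → ∣ + k * x ∣≤ + k * y → ∣ x ∣≤ y
  *-cancelˡ-∣∣≤ (ℕ.suc k) {x} {y} (bounds kx≤ky -kx≤ky) = bounds
    (ℤ.*-cancelˡ-≤-pos x y (+ ℕ.suc k) kx≤ky)
    (ℤ.*-cancelˡ-≤-pos (- x) y (+ ℕ.suc k)
                        (subst (_≤ + ℕ.suc k * y) (ℤ.neg-distribʳ-* (+ ℕ.suc k) x) -kx≤ky))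

  ∣∣≤-* : ∀ {x X y Y} → ∣ x ∣≤ X → ∣ y ∣≤ Y → ∣ x * y ∣≤ X * Y
  ∣∣≤-* {x} {X} {y} {Y} hx hy = +∣∣≤⇒∣∣≤ (subst (_≤ X * Y) ∣x∣∣y∣≡∣xy∣
    (ℤ.≤-trans (ℤ.*-monoʳ-≤-nonNeg (+ ∣ y ∣) (∣∣≤⇒+∣∣≤ hx))
               (ℤ.*-monoˡ-≤-nonNeg X {{nonNegative (∣∣≤-nonNeg hx)}} (∣∣≤⇒+∣∣≤ hy))))
    where
      ∣x∣∣y∣≡∣xy∣ : + ∣ x ∣ * + ∣ y ∣ ≡ + ∣ x * y ∣
      ∣x∣∣y∣≡∣xy∣ = trans (sym (ℤ.pos-* ∣ x ∣ ∣ y ∣)) (cong +_ (sym (ℤ.abs-* x y)))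

  square-nonNeg : ∀ s → + 0 ≤ s * s
  square-nonNeg (+ n)      = subst (+ 0 ≤_) (ℤ.pos-* n n) (+≤+ ℕ.z≤n)
  square-nonNeg -[1+ _ ]   = +≤+ ℕ.z≤n

  ∣2xy∣≤x²+y² : ∀ x y → ∣ + 2 * (x * y) ∣≤ x * x + y * y
  ∣2xy∣≤x²+y² x y = bounds (≤-by-square (x - y) (solve (x ∷ y ∷ [])))
                           (≤-by-square (x + y) (solve (x ∷ y ∷ [])))
    where
      ≤-by-square : ∀ {a b} s → a + s * s ≡ b → a ≤ b
      ≤-by-square {a} s refl = ℤ.i≤i+j a (s * s) {{nonNegative (square-nonNeg s)}}

module Summations where

  open import Data.Nat.Base as ℕ using (ℕ; zero; suc)
  open import Data.Fin.Base using (Fin)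
  import Data.Fin.Base as Fin
  import Data.Fin.Properties as Fin
  open import Data.Vec.Base using (Vec; []; _∷_)
  open import Data.Vec.Properties using (∷-injective; ≡-dec)
  open import Data.Integer.Base using (ℤ; +_; _+_; _*_; -_; _-_; _≤_; +≤+; nonNegative)
  import Data.Integer.Properties as ℤ
  open import Data.Integer.Tactic.RingSolver using (solve-∀)
  open import Data.Product using (∃; _,_; proj₁; proj₂)
  open import Function.Base using (_∘_)
  open import Function.Definitions using (Injective)
  open import Data.Empty using (⊥-elim)
  open import Relation.Nullary using (Dec; yes; no)
  open import Relation.Binary.Definitions using (DecidableEquality)
  open import Relation.Binary.PropositionalEquality
  open import Algebra.Properties.Semiring.Sum ℤ.+-*-semiring
    using (sum; sum-cong-≗; ∑-distrib-+; *-distribˡ-sum)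
  open import Algebra.Properties.CommutativeSemigroup ℤ.*-commutativeSemigroup using (x∙yz≈y∙xz)
  open AbsoluteBound

  record Summation (A : Set) : Set where
    field
      ∑        : (A → ℤ) → ℤ
      ∑-cong   : ∀ {f g} → (∀ x → f x ≡ g x) → ∑ f ≡ ∑ g
      ∑-+      : ∀ f g → ∑ (λ x → f x + g x) ≡ ∑ f + ∑ g
      ∑-*ˡ     : ∀ k f → ∑ (λ x → k * f x) ≡ k * ∑ f
      ∑-mono-≤ : ∀ {f g} → (∀ x → f x ≤ g x) → ∑ f ≤ ∑ g

    ∑-0 : ∑ (λ _ → + 0) ≡ + 0
    ∑-0 = ∑-*ˡ (+ 0) (λ _ → + 0)

    ∑-*ʳ : ∀ k f → ∑ (λ x → f x * k) ≡ ∑ f * k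
    ∑-*ʳ k f = trans (∑-cong (λ x → ℤ.*-comm (f x) k)) (trans (∑-*ˡ k f) (ℤ.*-comm k (∑ f)))

    ∑-neg : ∀ f → ∑ (λ x → - f x) ≡ - ∑ f
    ∑-neg f = trans (∑-cong (λ x → sym (ℤ.-1*i≡-i (f x)))) (trans (∑-*ˡ (- + 1) f) (ℤ.-1*i≡-i (∑ f)))

    ∑-- : ∀ f g → ∑ (λ x → f x - g x) ≡ ∑ f - ∑ g
    ∑-- f g = trans (∑-+ f (λ x → - g x)) (cong (_+_ (∑ f)) (∑-neg g))

    ∑-*-affine : ∀ (Q b : ℤ) (f g : A → ℤ) →
                 ∑ (λ x → f x * (Q * g x - b)) ≡ Q * ∑ (λ x → f x * g x) - b * ∑ f
    ∑-*-affine Q b f g = begin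
      ∑ (λ x → f x * (Q * g x - b))             ≡⟨ ∑-cong (λ x → distribute Q b (f x) (g x)) ⟩
      ∑ (λ x → Q * (f x * g x) - b * f x)       ≡⟨ ∑-- (λ x → Q * (f x * g x)) (λ x → b * f x) ⟩
      ∑ (λ x → Q * (f x * g x)) - ∑ (λ x → b * f x) ≡⟨ cong₂ _-_ (∑-*ˡ Q (λ x → f x * g x)) (∑-*ˡ b f) ⟩
      Q * ∑ (λ x → f x * g x) - b * ∑ f         ∎
      where
        open ≡-Reasoning
        distribute : ∀ Q b u v → u * (Q * v - b) ≡ Q * (u * v) - b * u
        distribute = solve-∀

    ∑-nonNeg : ∀ {f} → (∀ x → + 0 ≤ f x) → + 0 ≤ ∑ f
    ∑-nonNeg {f} 0≤f = subst (_≤ ∑ f) ∑-0 (∑-mono-≤ 0≤f)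

    ∑-∣∣≤ : ∀ {f g} → (∀ x → ∣ f x ∣≤ g x) → ∣ ∑ f ∣≤ ∑ g
    ∑-∣∣≤ {f} h = bounds (∑-mono-≤ (λ x → ∣_∣≤_.upper (h x)))
                         (subst (_≤ _) (∑-neg f) (∑-mono-≤ (λ x → ∣_∣≤_.lower (h x))))

    ∑-centred-product : ∀ Q a b (f g : A → ℤ) → ∑ (λ _ → + 1) ≡ Q → ∑ f ≡ a → ∑ g ≡ b →
                        ∑ (λ x → (Q * f x - a) * (Q * g x - b)) ≡ Q * (Q * ∑ (λ x → f x * g x) - a * b)
    ∑-centred-product Q a b f g ∑1≡Q ∑f≡a ∑g≡b = begin
      ∑ (λ x → (Q * f x - a) * (Q * g x - b))
        ≡⟨ ∑-cong (λ x → expand Q a b (f x) (g x)) ⟩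
      ∑ (λ x → Q * Q * (f x * g x) + (- (Q * b) * f x + (- (Q * a) * g x + a * b * + 1)))
        ≡⟨ ∑-linear (Q * Q) _ _ ⟩
      Q * Q * ∑ (λ x → f x * g x) + ∑ (λ x → - (Q * b) * f x + (- (Q * a) * g x + a * b * + 1))
        ≡⟨ cong (_+_ (Q * Q * ∑ (λ x → f x * g x))) (∑-linear (- (Q * b)) f _) ⟩
      Q * Q * ∑ (λ x → f x * g x) + (- (Q * b) * ∑ f + ∑ (λ x → - (Q * a) * g x + a * b * + 1))
        ≡⟨ cong (λ t → Q * Q * ∑ (λ x → f x * g x) + (- (Q * b) * ∑ f + t))
                (trans (∑-linear (- (Q * a)) g _) (cong (_+_ (- (Q * a) * ∑ g)) (∑-*ˡ (a * b) (λ _ → + 1)))) ⟩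
      Q * Q * ∑ (λ x → f x * g x) + (- (Q * b) * ∑ f + (- (Q * a) * ∑ g + a * b * ∑ (λ _ → + 1)))
        ≡⟨ cong₂ (λ u v → Q * Q * ∑ (λ x → f x * g x) + (- (Q * b) * u + v)) ∑f≡a
                 (cong₂ (λ u v → - (Q * a) * u + a * b * v) ∑g≡b ∑1≡Q) ⟩
      Q * Q * ∑ (λ x → f x * g x) + (- (Q * b) * a + (- (Q * a) * b + a * b * Q))
        ≡⟨ collect Q a b (∑ (λ x → f x * g x)) ⟩
      Q * (Q * ∑ (λ x → f x * g x) - a * b) ∎
      where
        open ≡-Reasoning
        expand : ∀ Q a b u v →
                 (Q * u - a) * (Q * v - b) ≡ Q * Q * (u * v) + (- (Q * b) * u + (- (Q * a) * v + a * b * + 1))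
        expand = solve-∀
        collect : ∀ Q a b s → Q * Q * s + (- (Q * b) * a + (- (Q * a) * b + a * b * Q)) ≡ Q * (Q * s - a * b)
        collect = solve-∀
        ∑-linear : ∀ k f g → ∑ (λ x → k * f x + g x) ≡ k * ∑ f + ∑ g
        ∑-linear k f g = trans (∑-+ (λ x → k * f x) g) (cong (_+ ∑ g) (∑-*ˡ k f))

    ∣2∑fg∣≤∑f²+∑g² : ∀ (f g : A → ℤ) →
                     ∣ + 2 * ∑ (λ x → f x * g x) ∣≤ ∑ (λ x → f x * f x) + ∑ (λ x → g x * g x)
    ∣2∑fg∣≤∑f²+∑g² f g = subst₂ ∣_∣≤_ (∑-*ˡ (+ 2) (λ x → f x * g x)) (∑-+ (λ x → f x * f x) (λ x → g x * g x))
      (∑-∣∣≤ {λ x → + 2 * (f x * g x)} {λ x → f x * f x + g x * g x} (λ x → ∣2xy∣≤x²+y² (f x) (g x)))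

  open Summation public

  module _ {A B C : Set} where

    nestedSum : Summation A → Summation B → (A → B → C) → Summation C
    nestedSum S T _∙_ = record
      { ∑        = λ f → ∑ S (λ a → ∑ T (λ b → f (a ∙ b)))
      ; ∑-cong   = λ f≗g → ∑-cong S (λ a → ∑-cong T (λ b → f≗g (a ∙ b)))
      ; ∑-+      = λ f g → trans (∑-cong S (λ a → ∑-+ T (λ b → f (a ∙ b)) (λ b → g (a ∙ b))))
                                 (∑-+ S _ _)
      ; ∑-*ˡ     = λ k f → trans (∑-cong S (λ a → ∑-*ˡ T k (λ b → f (a ∙ b)))) (∑-*ˡ S k _)
      ; ∑-mono-≤ = λ f≤g → ∑-mono-≤ S (λ a → ∑-mono-≤ T (λ b → f≤g (a ∙ b)))
      }

  weightedSum : ∀ {A : Set} → Summation A → (w : A → ℤ) → (∀ x → + 0 ≤ w x) → Summation A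
  weightedSum S w 0≤w = record
    { ∑        = λ f → ∑ S (λ x → w x * f x)
    ; ∑-cong   = λ f≗g → ∑-cong S (λ x → cong (w x *_) (f≗g x))
    ; ∑-+      = λ f g → trans (∑-cong S (λ x → ℤ.*-distribˡ-+ (w x) (f x) (g x))) (∑-+ S _ _)
    ; ∑-*ˡ     = λ k f → trans (∑-cong S (λ x → x∙yz≈y∙xz (w x) k (f x))) (∑-*ˡ S k _)
    ; ∑-mono-≤ = λ f≤g → ∑-mono-≤ S (λ x → ℤ.*-monoˡ-≤-nonNeg (w x) {{nonNegative (0≤w x)}} (f≤g x))
    }

  pointSum : ∀ {A : Set} → A → Summation A
  pointSum x = record
    { ∑        = λ f → f x
    ; ∑-cong   = λ f≗g → f≗g x
    ; ∑-+      = λ _ _ → refl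
    ; ∑-*ˡ     = λ _ _ → refl
    ; ∑-mono-≤ = λ f≤g → f≤g x
    }

  finSum : ∀ n → Summation (Fin n)
  finSum n = record
    { ∑        = sum
    ; ∑-cong   = sum-cong-≗
    ; ∑-+      = ∑-distrib-+
    ; ∑-*ˡ     = λ k f → sym (*-distribˡ-sum k f)
    ; ∑-mono-≤ = mono n
    }
    where
      mono : ∀ n {f g : Fin n → ℤ} → (∀ i → f i ≤ g i) → sum f ≤ sum g
      mono zero    _   = ℤ.≤-refl
      mono (suc n) f≤g = ℤ.+-mono-≤ (f≤g Fin.zero) (mono n (λ i → f≤g (Fin.suc i)))

  vecSum : ∀ m n → Summation (Vec (Fin m) n)
  vecSum m zero    = pointSum []
  vecSum m (suc n) = nestedSum (finSum m) (vecSum m n) _∷_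

  ∑-comm-finSum : ∀ {A} (S : Summation A) n (f : A → Fin n → ℤ) →
                  ∑ S (λ x → sum (f x)) ≡ sum (λ i → ∑ S (λ x → f x i))
  ∑-comm-finSum S zero    f = ∑-0 S
  ∑-comm-finSum S (suc n) f =
    trans (∑-+ S (λ x → f x Fin.zero) (λ x → sum (λ i → f x (Fin.suc i))))
          (cong (_+_ (∑ S (λ x → f x Fin.zero))) (∑-comm-finSum S n (λ x i → f x (Fin.suc i))))

  ∑-comm-vecSum : ∀ {A} (S : Summation A) m n (f : A → Vec (Fin m) n → ℤ) →
                  ∑ S (λ x → ∑ (vecSum m n) (f x)) ≡ ∑ (vecSum m n) (λ v → ∑ S (λ x → f x v))
  ∑-comm-vecSum S m zero    f = refl
  ∑-comm-vecSum S m (suc n) f = trans (∑-comm-finSum S m _)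
    (sum-cong-≗ (λ a → ∑-comm-vecSum S m n (λ x v → f x (a ∷ v))))

  module _ {A : Set} (_≟_ : DecidableEquality A) where

    δ : A → A → ℤ
    δ x y with x ≟ y
    ... | yes _ = + 1
    ... | no  _ = + 0

    δ-≡ : ∀ {x y} → x ≡ y → δ x y ≡ + 1
    δ-≡ {x} {y} x≡y with x ≟ y
    ... | yes _   = refl
    ... | no  x≢y = ⊥-elim (x≢y x≡y)

    δ-refl : ∀ x → δ x x ≡ + 1
    δ-refl x = δ-≡ refl

    δ-≢ : ∀ {x y} → x ≢ y → δ x y ≡ + 0
    δ-≢ {x} {y} x≢y with x ≟ y
    ... | yes x≡y = ⊥-elim (x≢y x≡y)
    ... | no  _   = refl

    δ≢0⇒≡ : ∀ {x y} → δ x y ≢ + 0 → x ≡ y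
    δ≢0⇒≡ {x} {y} δ≢0 with x ≟ y
    ... | yes x≡y = x≡y
    ... | no  _   = ⊥-elim (δ≢0 refl)

    δ-sym : ∀ x y → δ x y ≡ δ y x
    δ-sym x y with x ≟ y
    ... | yes x≡y = sym (δ-≡ (sym x≡y))
    ... | no  x≢y = sym (δ-≢ (x≢y ∘ sym))

    δ-nonNeg : ∀ x y → + 0 ≤ δ x y
    δ-nonNeg x y with x ≟ y
    ... | yes _ = +≤+ ℕ.z≤n
    ... | no  _ = +≤+ ℕ.z≤n

    δ≤1 : ∀ x y → δ x y ≤ + 1
    δ≤1 x y with x ≟ y
    ... | yes _ = +≤+ (ℕ.s≤s ℕ.z≤n)
    ... | no  _ = +≤+ ℕ.z≤n

  δ-resp-⇔ : ∀ {A B : Set} (_≟ᴬ_ : DecidableEquality A) (_≟ᴮ_ : DecidableEquality B) {x y : A} {u v : B} →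
             (x ≡ y → u ≡ v) → (u ≡ v → x ≡ y) → δ _≟ᴬ_ x y ≡ δ _≟ᴮ_ u v
  δ-resp-⇔ _≟ᴬ_ _≟ᴮ_ {x} {y} to from with x ≟ᴬ y
  ... | yes x≡y = sym (δ-≡ _≟ᴮ_ (to x≡y))
  ... | no  x≢y = sym (δ-≢ _≟ᴮ_ (x≢y ∘ from))

  δᶠ : ∀ {n} → Fin n → Fin n → ℤ
  δᶠ = δ Fin._≟_

  δᵛ : ∀ {m n} → Vec (Fin m) n → Vec (Fin m) n → ℤ
  δᵛ = δ (≡-dec Fin._≟_)

  δᶠ-suc : ∀ {n} (x y : Fin n) → δᶠ (Fin.suc x) (Fin.suc y) ≡ δᶠ x y
  δᶠ-suc x y = sym (δ-resp-⇔ Fin._≟_ Fin._≟_ {x} {y} (cong Fin.suc) Fin.suc-injective)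

  ∑ᶠ-δ : ∀ {n} (x : Fin n) (f : Fin n → ℤ) → sum (λ y → δᶠ x y * f y) ≡ f x
  ∑ᶠ-δ {suc n} Fin.zero f = begin
    sum (λ y → δᶠ Fin.zero y * f y)
      ≡⟨ cong₂ _+_ (cong (_* f Fin.zero) (δ-refl Fin._≟_ (Fin.zero {n}))) (trans (sum-cong-≗ others) (∑-0 (finSum n))) ⟩
    + 1 * f Fin.zero + + 0
      ≡⟨ trans (ℤ.+-identityʳ _) (ℤ.*-identityˡ _) ⟩
    f Fin.zero ∎
    where
      open ≡-Reasoning
      others : ∀ y → δᶠ Fin.zero (Fin.suc y) * f (Fin.suc y) ≡ + 0
      others y = cong (_* f (Fin.suc y)) (δ-≢ Fin._≟_ {Fin.zero} {Fin.suc y} (λ ()))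
  ∑ᶠ-δ {suc n} (Fin.suc x) f = begin
    sum (λ y → δᶠ (Fin.suc x) y * f y)
      ≡⟨ cong₂ _+_ (cong (_* f Fin.zero) (δ-≢ Fin._≟_ {Fin.suc x} {Fin.zero} (λ ())))
                   (sum-cong-≗ (λ y → cong (_* f (Fin.suc y)) (δᶠ-suc x y))) ⟩
    + 0 + sum (λ y → δᶠ x y * f (Fin.suc y))
      ≡⟨ trans (ℤ.+-identityˡ _) (∑ᶠ-δ x (f ∘ Fin.suc)) ⟩
    f (Fin.suc x) ∎
    where open ≡-Reasoning

  δᵛ-∷ : ∀ {m n} (x y : Fin m) (xs ys : Vec (Fin m) n) → δᵛ (x ∷ xs) (y ∷ ys) ≡ δᶠ x y * δᵛ xs ys
  δᵛ-∷ x y xs ys = by-cases (x Fin.≟ y)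
    where
      by-cases : Dec (x ≡ y) → δᵛ (x ∷ xs) (y ∷ ys) ≡ δᶠ x y * δᵛ xs ys
      by-cases (yes x≡y) = begin
        δᵛ (x ∷ xs) (y ∷ ys)  ≡⟨ δ-resp-⇔ (≡-dec Fin._≟_) (≡-dec Fin._≟_) {x ∷ xs} {y ∷ ys}
                                          (proj₂ ∘ ∷-injective) (cong₂ _∷_ x≡y) ⟩
        δᵛ xs ys              ≡⟨ ℤ.*-identityˡ _ ⟨
        + 1 * δᵛ xs ys        ≡⟨ cong (_* δᵛ xs ys) (δ-≡ Fin._≟_ x≡y) ⟨
        δᶠ x y * δᵛ xs ys     ∎
        where open ≡-Reasoning
      by-cases (no x≢y) = trans (δ-≢ (≡-dec Fin._≟_) {x ∷ xs} {y ∷ ys} (x≢y ∘ proj₁ ∘ ∷-injective))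
                                (sym (cong (_* δᵛ xs ys) (δ-≢ Fin._≟_ x≢y)))

  ∑ᵛ-δ : ∀ {m n} (x : Vec (Fin m) n) (f : Vec (Fin m) n → ℤ) → ∑ (vecSum m n) (λ y → δᵛ x y * f y) ≡ f x
  ∑ᵛ-δ {m} [] f = trans (cong (_* f []) (δ-refl (≡-dec (Fin._≟_ {m})) [])) (ℤ.*-identityˡ (f []))
  ∑ᵛ-δ {m} {suc n} (x ∷ xs) f = begin
    sum (λ a → ∑ (vecSum m n) (λ v → δᵛ (x ∷ xs) (a ∷ v) * f (a ∷ v)))
      ≡⟨ sum-cong-≗ (λ a → trans (∑-cong (vecSum m n) (λ v → trans (cong (_* f (a ∷ v)) (δᵛ-∷ x a xs v))
                                                                 (ℤ.*-assoc (δᶠ x a) (δᵛ xs v) (f (a ∷ v)))))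
                                  (∑-*ˡ (vecSum m n) (δᶠ x a) _)) ⟩
    sum (λ a → δᶠ x a * ∑ (vecSum m n) (λ v → δᵛ xs v * f (a ∷ v)))
      ≡⟨ sum-cong-≗ (λ a → cong (δᶠ x a *_) (∑ᵛ-δ xs (λ v → f (a ∷ v)))) ⟩
    sum (λ a → δᶠ x a * f (a ∷ xs))
      ≡⟨ ∑ᶠ-δ x (λ a → f (a ∷ xs)) ⟩
    f (x ∷ xs) ∎
    where open ≡-Reasoning

  ∑ᵛ-δ-row : ∀ {m n} (x : Vec (Fin m) n) → ∑ (vecSum m n) (δᵛ x) ≡ + 1
  ∑ᵛ-δ-row {m} {n} x = trans (∑-cong (vecSum m n) (λ y → sym (ℤ.*-identityʳ (δᵛ x y)))) (∑ᵛ-δ x (λ _ → + 1))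

  sum-const : ∀ n k → sum {n} (λ _ → k) ≡ + n * k
  sum-const zero    k = refl
  sum-const (suc n) k = trans (cong (_+_ k) (sum-const n k)) (sym (ℤ.suc-* (+ n) k))

  ∑ᵛ-const : ∀ m n k → ∑ (vecSum m n) (λ _ → k) ≡ + (m ℕ.^ n) * k
  ∑ᵛ-const m zero    k = sym (ℤ.*-identityˡ k)
  ∑ᵛ-const m (suc n) k = begin
    sum {m} (λ _ → ∑ (vecSum m n) (λ _ → k)) ≡⟨ sum-cong-≗ {m} (λ _ → ∑ᵛ-const m n k) ⟩
    sum {m} (λ _ → + (m ℕ.^ n) * k)       ≡⟨ sum-const m _ ⟩
    + m * (+ (m ℕ.^ n) * k)               ≡⟨ ℤ.*-assoc (+ m) _ k ⟨
    + m * + (m ℕ.^ n) * k                 ≡⟨ cong (_* k) (ℤ.pos-* m (m ℕ.^ n)) ⟨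
    + (m ℕ.^ suc n) * k                   ∎
    where open ≡-Reasoning

  sum≢0⇒term≢0 : ∀ {n} (f : Fin n → ℤ) → sum f ≢ + 0 → ∃ λ i → f i ≢ + 0
  sum≢0⇒term≢0 {zero}  f sum≢0 = ⊥-elim (sum≢0 refl)
  sum≢0⇒term≢0 {suc n} f sum≢0 with f Fin.zero ℤ.≟ + 0
  ... | no  f₀≢0 = Fin.zero , f₀≢0
  ... | yes f₀≡0 with sum≢0⇒term≢0 (f ∘ Fin.suc) (λ rest≡0 → sum≢0 (cong₂ _+_ f₀≡0 rest≡0))
  ...   | i , fᵢ≢0 = Fin.suc i , fᵢ≢0

  ∑ᵛ≢0⇒term≢0 : ∀ {m n} (f : Vec (Fin m) n → ℤ) → ∑ (vecSum m n) f ≢ + 0 → ∃ λ x → f x ≢ + 0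
  ∑ᵛ≢0⇒term≢0 {n = zero}  f f[]≢0 = [] , f[]≢0
  ∑ᵛ≢0⇒term≢0 {n = suc n} f sum≢0 with sum≢0⇒term≢0 _ sum≢0
  ... | a , ∑ₐ≢0 with ∑ᵛ≢0⇒term≢0 (λ v → f (a ∷ v)) ∑ₐ≢0
  ...   | v , fₐᵥ≢0 = a ∷ v , fₐᵥ≢0

  term≤∑ᵛ : ∀ {m n} (f : Vec (Fin m) n → ℤ) → (∀ y → + 0 ≤ f y) → ∀ x → f x ≤ ∑ (vecSum m n) f
  term≤∑ᵛ {m} {n} f 0≤f x = subst (_≤ ∑ (vecSum m n) f) (∑ᵛ-δ x f) (∑-mono-≤ (vecSum m n) δf≤f)
    where
      δf≤f : ∀ y → δᵛ x y * f y ≤ f y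
      δf≤f y = subst (δᵛ x y * f y ≤_) (ℤ.*-identityˡ (f y))
                     (ℤ.*-monoʳ-≤-nonNeg (f y) {{nonNegative (0≤f y)}} (δ≤1 (≡-dec Fin._≟_) x y))

  module _ {m n} {B : Set} (_≟ᴮ_ : DecidableEquality B) (φ : Vec (Fin m) n → B)
           (φ-injective : Injective _≡_ _≡_ φ) where

    fibre-size : B → ℤ
    fibre-size y = ∑ (vecSum m n) (λ x → δ _≟ᴮ_ (φ x) y)

    fibre-size≤1 : ∀ y → fibre-size y ≤ + 1
    fibre-size≤1 y with fibre-size y ℤ.≟ + 0
    ... | yes size≡0 = subst (_≤ + 1) (sym size≡0) (+≤+ ℕ.z≤n)
    ... | no  size≢0 with ∑ᵛ≢0⇒term≢0 _ size≢0
    ...   | x₀ , δ≢0 = ℤ.≤-reflexive (trans (∑-cong (vecSum m n) same-fibre) (∑ᵛ-δ-row x₀))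
      where
        φx₀≡y : φ x₀ ≡ y
        φx₀≡y = δ≢0⇒≡ _≟ᴮ_ δ≢0
        same-fibre : ∀ x → δ _≟ᴮ_ (φ x) y ≡ δᵛ x₀ x
        same-fibre x = δ-resp-⇔ _≟ᴮ_ (≡-dec Fin._≟_) (λ φx≡y → φ-injective (trans φx₀≡y (sym φx≡y)))
                                                     (λ x₀≡x → trans (cong φ (sym x₀≡x)) φx₀≡y)

  -- An injective self-map of a finite set is onto: its fibres have size ≤ 1 and their
  -- sizes add up to the number of points, so each has size exactly 1.
  ∑ᵛ-reindex : ∀ {m n} (φ : Vec (Fin m) n → Vec (Fin m) n) → Injective _≡_ _≡_ φ →
               ∀ f → ∑ (vecSum m n) (λ x → f (φ x)) ≡ ∑ (vecSum m n) f
  ∑ᵛ-reindex {m} {n} φ φ-injective f = begin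
    ∑ᵥ (λ x → f (φ x))                      ≡⟨ ∑-cong V (λ x → sym (∑ᵛ-δ (φ x) f)) ⟩
    ∑ᵥ (λ x → ∑ᵥ (λ y → δᵛ (φ x) y * f y))  ≡⟨ ∑-comm-vecSum V m n _ ⟩
    ∑ᵥ (λ y → ∑ᵥ (λ x → δᵛ (φ x) y * f y))  ≡⟨ ∑-cong V (λ y → ∑-*ʳ V (f y) _) ⟩
    ∑ᵥ (λ y → size y * f y)                 ≡⟨ ∑-cong V (λ y → trans (cong (_* f y) (size≡1 y)) (ℤ.*-identityˡ (f y))) ⟩
    ∑ᵥ f                                    ∎
    where
      open ≡-Reasoning
      V = vecSum m n
      ∑ᵥ = ∑ V
      size = fibre-size (≡-dec Fin._≟_) φ φ-injective

      ∑-size : ∑ᵥ size ≡ ∑ᵥ (λ _ → + 1)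
      ∑-size = trans (sym (∑-comm-vecSum V m n (λ x y → δᵛ (φ x) y)))
                     (∑-cong V (λ x → ∑ᵛ-δ-row (φ x)))

      ∑-deficit≡0 : ∑ᵥ (λ y → + 1 - size y) ≡ + 0
      ∑-deficit≡0 = trans (∑-- V (λ _ → + 1) size)
                          (trans (cong (_-_ (∑ᵥ (λ _ → + 1))) ∑-size) (ℤ.+-inverseʳ (∑ᵥ (λ _ → + 1))))

      size≡1 : ∀ y → size y ≡ + 1
      size≡1 y = ℤ.≤-antisym (fibre-size≤1 (≡-dec Fin._≟_) φ φ-injective y) (ℤ.i-j≤0⇒i≤j
        (subst (+ 1 - size y ≤_) ∑-deficit≡0
          (term≤∑ᵛ _ (λ y → ℤ.i≤j⇒0≤j-i (fibre-size≤1 (≡-dec Fin._≟_) φ φ-injective y)) y)))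

module FilterLength where

  open import Data.Nat.Base as ℕ using (zero; suc)
  open import Data.Fin.Base as Fin using (Fin)
  open import Data.List.Base using (List; []; _∷_; _++_; map; length; filter; concat; tabulate)
  open import Data.List.Properties using (filter-++; length-++)
  open import Data.Integer.Base using (+_; _+_)
  import Data.Integer.Properties as ℤ
  open import Algebra.Properties.Semiring.Sum ℤ.+-*-semiring using (sum)
  open import Relation.Nullary using (yes; no)
  open import Relation.Unary using (Pred; Decidable)
  open import Level using (0ℓ)
  open import Function.Base using (_∘′_)
  open import Relation.Binary.PropositionalEquality

  length-filter-map : ∀ {A B : Set} {P : Pred B 0ℓ} (P? : Decidable P) (f : A → B) xs →
                      length (filter P? (map f xs)) ≡ length (filter (λ x → P? (f x)) xs)
  length-filter-map P? f []       = refl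
  length-filter-map P? f (x ∷ xs) with P? (f x)
  ... | yes _ = cong suc (length-filter-map P? f xs)
  ... | no  _ = length-filter-map P? f xs

  length-filter-concat : ∀ {B : Set} {P : Pred B 0ℓ} (P? : Decidable P) {n} (f : Fin n → List B) →
                         + length (filter P? (concat (tabulate f))) ≡ sum (λ i → + length (filter P? (f i)))
  length-filter-concat P? {zero}  f = refl
  length-filter-concat P? {suc n} f = begin
    + length (filter P? (f Fin.zero ++ concat (tabulate (f ∘′ Fin.suc))))
      ≡⟨ cong (λ xs → + length xs) (filter-++ P? (f Fin.zero) _) ⟩
    + length (filter P? (f Fin.zero) ++ filter P? (concat (tabulate (f ∘′ Fin.suc))))
      ≡⟨ cong +_ (length-++ (filter P? (f Fin.zero))) ⟩
    + (length (filter P? (f Fin.zero)) ℕ.+ length (filter P? (concat (tabulate (f ∘′ Fin.suc)))))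
      ≡⟨ ℤ.pos-+ (length (filter P? (f Fin.zero))) _ ⟩
    + length (filter P? (f Fin.zero)) + + length (filter P? (concat (tabulate (f ∘′ Fin.suc))))
      ≡⟨ cong (_+_ (+ length (filter P? (f Fin.zero)))) (length-filter-concat P? (f ∘′ Fin.suc)) ⟩
    sum (λ i → + length (filter P? (f i)))  ∎
    where open ≡-Reasoning

module Fractions where

  open import Data.Nat.Base as ℕ using (zero; suc; NonZero)
  open import Data.Integer.Base using (ℤ; +_; _+_; _*_; -_; _≤_; +≤+; ∣_∣; Positive; _^_)
  import Data.Integer.Properties as ℤ
  open import Data.Integer.Tactic.RingSolver using (solve-∀)
  open import Data.Rational.Unnormalised.Base as ℚᵘ using (ℚᵘ; mkℚᵘ; *≡*; *≤*)
  open import Data.Rational.Base as ℚ using (ℚ; toℚᵘ)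
  import Data.Rational.Properties as ℚ
  open import Algebra.Properties.CommutativeSemigroup ℤ.*-commutativeSemigroup
    using (interchange; xy∙z≈xz∙y)
  open import Relation.Binary.PropositionalEquality

  infix 4 _≐ᵘ_÷_ _≐_÷_

  -- x = n / d by cross-multiplication, so n / d need not be in lowest terms.
  record _≐ᵘ_÷_ (x : ℚᵘ) (n d : ℤ) : Set where
    constructor cross
    field cross-≡ : ℚᵘ.↥ x * d ≡ n * ℚᵘ.↧ x

  ≐ᵘ-resp-≃ : ∀ {x y n d} → x ℚᵘ.≃ y → y ≐ᵘ n ÷ d → x ≐ᵘ n ÷ d
  ≐ᵘ-resp-≃ {mkℚᵘ a a-1} {mkℚᵘ b b-1} {n} {d} (*≡* a[b]≡b[a]) (cross bd≡n[b]) =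
    cross (ℤ.*-cancelʳ-≡ (a * d) (n * [a]) [b] (begin
      a * d * [b]    ≡⟨ xy∙z≈xz∙y a d [b] ⟩
      a * [b] * d    ≡⟨ cong (_* d) a[b]≡b[a] ⟩
      b * [a] * d    ≡⟨ xy∙z≈xz∙y b [a] d ⟩
      b * d * [a]    ≡⟨ cong (_* [a]) bd≡n[b] ⟩
      n * [b] * [a]  ≡⟨ xy∙z≈xz∙y n [b] [a] ⟩
      n * [a] * [b]  ∎))
    where
      open ≡-Reasoning
      [a] = + suc a-1
      [b] = + suc b-1

  *-≐ᵘ : ∀ {x y n m d e} → x ≐ᵘ n ÷ d → y ≐ᵘ m ÷ e → x ℚᵘ.* y ≐ᵘ n * m ÷ (d * e)
  *-≐ᵘ {mkℚᵘ a a-1} {mkℚᵘ b b-1} {n} {m} {d} {e} (cross ad≡n[a]) (cross be≡m[b]) = cross (begin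
    a * b * (d * e)          ≡⟨ interchange a b d e ⟩
    a * d * (b * e)          ≡⟨ cong₂ _*_ ad≡n[a] be≡m[b] ⟩
    n * [a] * (m * [b])      ≡⟨ interchange n [a] m [b] ⟩
    n * m * ([a] * [b])      ≡⟨ cong (n * m *_) (ℤ.pos-* (suc a-1) (suc b-1)) ⟨
    n * m * + (suc a-1 ℕ.* suc b-1) ∎)
    where
      open ≡-Reasoning
      [a] = + suc a-1
      [b] = + suc b-1

  +-≐ᵘ : ∀ {x y n m d e} → x ≐ᵘ n ÷ d → y ≐ᵘ m ÷ e → x ℚᵘ.+ y ≐ᵘ n * e + m * d ÷ (d * e)
  +-≐ᵘ {mkℚᵘ a a-1} {mkℚᵘ b b-1} {n} {m} {d} {e} (cross ad≡n[a]) (cross be≡m[b]) = cross (begin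
    (a * [b] + b * [a]) * (d * e)         ≡⟨ expand a [b] b [a] d e ⟩
    a * d * [b] * e + b * e * [a] * d     ≡⟨ cong₂ (λ u v → u * [b] * e + v * [a] * d) ad≡n[a] be≡m[b] ⟩
    n * [a] * [b] * e + m * [b] * [a] * d ≡⟨ collect n [a] [b] e m d ⟩
    (n * e + m * d) * ([a] * [b])         ≡⟨ cong ((n * e + m * d) *_) (ℤ.pos-* (suc a-1) (suc b-1)) ⟨
    (n * e + m * d) * + (suc a-1 ℕ.* suc b-1) ∎)
    where
      open ≡-Reasoning
      [a] = + suc a-1
      [b] = + suc b-1
      expand : ∀ a B b A d e → (a * B + b * A) * (d * e) ≡ a * d * B * e + b * e * A * d
      expand = solve-∀
      collect : ∀ n A B e m d → n * A * B * e + m * B * A * d ≡ (n * e + m * d) * (A * B)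
      collect = solve-∀

  neg-≐ᵘ : ∀ {x n d} → x ≐ᵘ n ÷ d → ℚᵘ.- x ≐ᵘ - n ÷ d
  neg-≐ᵘ {mkℚᵘ a a-1} {n} {d} (cross ad≡n[a]) =
    cross (trans (sym (ℤ.neg-distribˡ-* a d)) (trans (cong -_ ad≡n[a]) (ℤ.neg-distribˡ-* n _)))

  ∣∣-≐ᵘ : ∀ {x n d} → x ≐ᵘ n ÷ + d → ℚᵘ.∣ x ∣ ≐ᵘ + ∣ n ∣ ÷ + d
  ∣∣-≐ᵘ {mkℚᵘ a a-1} {n} {d} (cross ad≡n[a]) = cross (begin
    + ∣ a ∣ * + d              ≡⟨ ℤ.pos-* ∣ a ∣ d ⟨
    + (∣ a ∣ ℕ.* d)            ≡⟨ cong +_ (ℤ.abs-* a (+ d)) ⟨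
    + ∣ a * + d ∣              ≡⟨ cong (λ t → + ∣ t ∣) ad≡n[a] ⟩
    + ∣ n * + suc a-1 ∣        ≡⟨ cong +_ (ℤ.abs-* n (+ suc a-1)) ⟩
    + (∣ n ∣ ℕ.* suc a-1)      ≡⟨ ℤ.pos-* ∣ n ∣ (suc a-1) ⟩
    + ∣ n ∣ * + suc a-1        ∎)
    where open ≡-Reasoning

  ≤-≐ᵘ : ∀ {x y n m d e} .{{_ : Positive d}} .{{_ : Positive e}} →
         x ≐ᵘ n ÷ d → y ≐ᵘ m ÷ e → n * e ≤ m * d → x ℚᵘ.≤ y
  ≤-≐ᵘ {mkℚᵘ a a-1} {mkℚᵘ b b-1} {n} {m} {d} {e} (cross ad≡n[a]) (cross be≡m[b]) ne≤md =
    *≤* (ℤ.*-cancelʳ-≤-pos (a * [b]) (b * [a]) d (ℤ.*-cancelʳ-≤-pos (a * [b] * d) (b * [a] * d) e (begin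
      a * [b] * d * e          ≡⟨ regroup a [b] d e ⟩
      a * d * ([b] * e)        ≡⟨ cong (_* ([b] * e)) ad≡n[a] ⟩
      n * [a] * ([b] * e)      ≡⟨ swap n [a] [b] e ⟩
      n * e * ([a] * [b])      ≤⟨ ℤ.*-monoʳ-≤-nonNeg ([a] * [b]) ne≤md ⟩
      m * d * ([a] * [b])      ≡⟨ swap′ m [a] [b] d ⟨
      m * [b] * ([a] * d)      ≡⟨ cong (_* ([a] * d)) be≡m[b] ⟨
      b * e * ([a] * d)        ≡⟨ regroup′ b [a] d e ⟨
      b * [a] * d * e          ∎)))
    where
      open ℤ.≤-Reasoning
      [a] = + suc a-1
      [b] = + suc b-1
      regroup : ∀ a B d e → a * B * d * e ≡ a * d * (B * e)
      regroup = solve-∀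
      regroup′ : ∀ b A d e → b * A * d * e ≡ b * e * (A * d)
      regroup′ = solve-∀
      swap : ∀ n A B e → n * A * (B * e) ≡ n * e * (A * B)
      swap = solve-∀
      swap′ : ∀ m A B d → m * B * (A * d) ≡ m * d * (A * B)
      swap′ = solve-∀

  -- ℚ normalises its results, so representations are tracked through toℚᵘ.
  record _≐_÷_ (x : ℚ) (n d : ℤ) : Set where
    constructor viaℚᵘ
    field toℚᵘ-≐ : toℚᵘ x ≐ᵘ n ÷ d
  open _≐_÷_

  ≐-cong : ∀ {x n n′ d d′} → n ≡ n′ → d ≡ d′ → x ≐ n ÷ d → x ≐ n′ ÷ d′
  ≐-cong refl refl x≐ = x≐

  frac-≐ : ∀ a b .{{_ : NonZero b}} → frac a b ≐ + a ÷ + b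
  frac-≐ a (suc b) = viaℚᵘ (≐ᵘ-resp-≃ (ℚ.toℚᵘ-fromℚᵘ (mkℚᵘ (+ a) b)) (cross refl))

  1-≐ : ℚ.1ℚ ≐ + 1 ÷ + 1
  1-≐ = viaℚᵘ (cross refl)

  *-≐ : ∀ {x y n m d e} → x ≐ n ÷ d → y ≐ m ÷ e → x ℚ.* y ≐ n * m ÷ (d * e)
  *-≐ {x} {y} (viaℚᵘ x≐) (viaℚᵘ y≐) = viaℚᵘ (≐ᵘ-resp-≃ (ℚ.toℚᵘ-homo-* x y) (*-≐ᵘ x≐ y≐))

  +-≐ : ∀ {x y n m d e} → x ≐ n ÷ d → y ≐ m ÷ e → x ℚ.+ y ≐ n * e + m * d ÷ (d * e)
  +-≐ {x} {y} (viaℚᵘ x≐) (viaℚᵘ y≐) = viaℚᵘ (≐ᵘ-resp-≃ (ℚ.toℚᵘ-homo-+ x y) (+-≐ᵘ x≐ y≐))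

  neg-≐ : ∀ {x n d} → x ≐ n ÷ d → ℚ.- x ≐ - n ÷ d
  neg-≐ {x} (viaℚᵘ x≐) = viaℚᵘ (≐ᵘ-resp-≃ (ℚ.toℚᵘ-homo‿- x) (neg-≐ᵘ x≐))

  ∣∣-≐ : ∀ {x n d} → x ≐ n ÷ + d → ℚ.∣ x ∣ ≐ + ∣ n ∣ ÷ + d
  ∣∣-≐ {x} (viaℚᵘ x≐) = viaℚᵘ (≐ᵘ-resp-≃ (ℚ.toℚᵘ-homo-∣-∣ x) (∣∣-≐ᵘ x≐))

  powQ-≐ : ∀ {x n d} k → x ≐ n ÷ d → powQ x k ≐ n ^ k ÷ d ^ k
  powQ-≐ zero    _  = 1-≐
  powQ-≐ (suc k) x≐ = *-≐ x≐ (powQ-≐ k x≐)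

  ≤-≐ : ∀ {x y n m d e} .{{_ : Positive d}} .{{_ : Positive e}} →
        x ≐ n ÷ d → y ≐ m ÷ e → n * e ≤ m * d → x ℚ.≤ y
  ≤-≐ (viaℚᵘ x≐) (viaℚᵘ y≐) ne≤md = ℚ.toℚᵘ-cancel-≤ (≤-≐ᵘ x≐ y≐ ne≤md)

  pos-^ : ∀ m k → + (m ℕ.^ k) ≡ (+ m) ^ k
  pos-^ m zero    = refl
  pos-^ m (suc k) = trans (ℤ.pos-* m (m ℕ.^ k)) (cong (+ m *_) (pos-^ m k))

  positive : ∀ k .{{_ : NonZero k}} → Positive (+ k)
  positive (suc k) = _

  ≤-by-ℕ : ∀ {x y a k m l} .{{_ : NonZero m}} .{{_ : NonZero l}} →
           x ≐ + a ÷ + m → y ≐ + k ÷ + l → a ℕ.* l ℕ.≤ k ℕ.* m → x ℚ.≤ y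
  ≤-by-ℕ {a = a} {k} {m} {l} x≐ y≐ al≤km =
    ≤-≐ {{positive m}} {{positive l}} x≐ y≐ (subst₂ _≤_ (ℤ.pos-* a l) (ℤ.pos-* k m) (+≤+ al≤km))

module PowerBounds where

  open import Data.Nat.Base
  open import Data.Nat.Properties
  open import Data.Nat.Tactic.RingSolver using (solve-∀)
  open import Relation.Binary.PropositionalEquality

  ^-increment : ∀ q k → suc q ^ suc k ≤ suc q * q ^ k + k * suc q ^ k
  ^-increment q zero    = m≤m+n (suc q * 1) 0
  ^-increment q (suc k) = begin
    suc q * suc q ^ suc k                                           ≤⟨ *-monoʳ-≤ (suc q) (^-increment q k) ⟩
    suc q * (suc q * q ^ k + k * suc q ^ k)                         ≡⟨ expand q (q ^ k) k (suc q ^ k) ⟩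
    suc q * (q * q ^ k) + suc q * q ^ k + k * suc q ^ suc k          ≤⟨ +-monoˡ-≤ (k * suc q ^ suc k)
                                                                        (+-monoʳ-≤ (suc q * (q * q ^ k)) (*-monoʳ-≤ (suc q) (^-monoˡ-≤ k (n≤1+n q)))) ⟩
    suc q * (q * q ^ k) + suc q * suc q ^ k + k * suc q ^ suc k      ≡⟨ collect q (q ^ k) k (suc q ^ k) ⟩
    suc q * q ^ suc k + suc k * suc q ^ suc k                        ∎
    where
      open ≤-Reasoning
      expand : ∀ q x k y → (1 + q) * ((1 + q) * x + k * y) ≡ (1 + q) * (q * x) + (1 + q) * x + k * ((1 + q) * y)
      expand = solve-∀
      collect : ∀ q x k y → (1 + q) * (q * x) + (1 + q) * y + k * ((1 + q) * y) ≡ (1 + q) * (q * x) + (1 + k) * ((1 + q) * y)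
      collect = solve-∀

  *-^ : ∀ m n k → (m * n) ^ k ≡ m ^ k * n ^ k
  *-^ m n zero    = refl
  *-^ m n (suc k) = trans (cong (m * n *_) (*-^ m n k)) (interchange m n (m ^ k) (n ^ k))
    where
      interchange : ∀ a b x y → a * b * (x * y) ≡ a * x * (b * y)
      interchange = solve-∀

  gap-bound : ∀ {p} k → 2 ≤ p → p * (p ^ k ∸ (p ∸ 1) ^ k) ≤ k * 2 ^ k * (p ∸ 1) ^ k
  gap-bound {suc q} k (s≤s 1≤q) = begin
    suc q * (suc q ^ k ∸ q ^ k)         ≡⟨ *-distribˡ-∸ (suc q) (suc q ^ k) (q ^ k) ⟩
    suc q ^ suc k ∸ suc q * q ^ k       ≤⟨ m≤n+o⇒m∸n≤o _ _ (^-increment q k) ⟩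
    k * suc q ^ k                       ≤⟨ *-monoʳ-≤ k (^-monoˡ-≤ k 1+q≤2q) ⟩
    k * (2 * q) ^ k                     ≡⟨ cong (k *_) (*-^ 2 q k) ⟩
    k * (2 ^ k * q ^ k)                 ≡⟨ *-assoc k (2 ^ k) (q ^ k) ⟨
    k * 2 ^ k * q ^ k                   ∎
    where
      open ≤-Reasoning
      1+q≤2q : suc q ≤ 2 * q
      1+q≤2q = subst (suc q ≤_) (cong (q +_) (sym (+-identityʳ q))) (+-monoˡ-≤ q 1≤q)

  square-cancel-bound : ∀ {a b e r p k K} .{{_ : NonZero r}} →
                        r ^ 2 * a ≤ b * e ^ 2 → p * e ≤ k * r → k ^ 2 ≤ K → a * p ^ 2 ≤ K * b
  square-cancel-bound {a} {b} {e} {r} {p} {k} {K} r²a≤be² pe≤kr k²≤K =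
    *-cancelʳ-≤ (a * p ^ 2) (K * b) (r ^ 2) {{m^n≢0 r 2}} (begin
      a * p ^ 2 * r ^ 2            ≡⟨ shuffle₁ a p r ⟩
      p ^ 2 * (r ^ 2 * a)          ≤⟨ *-monoʳ-≤ (p ^ 2) r²a≤be² ⟩
      p ^ 2 * (b * e ^ 2)          ≡⟨ shuffle₂ p b e ⟩
      b * ((p * e) * (p * e))      ≤⟨ *-monoʳ-≤ b (*-mono-≤ pe≤kr pe≤kr) ⟩
      b * ((k * r) * (k * r))      ≡⟨ shuffle₃ b k r ⟩
      k ^ 2 * b * r ^ 2            ≤⟨ *-monoˡ-≤ (r ^ 2) (*-monoˡ-≤ b k²≤K) ⟩
      K * b * r ^ 2                ∎)
    where
      open ≤-Reasoning
      shuffle₁ : ∀ a p r → a * (p * (p * 1)) * (r * (r * 1)) ≡ p * (p * 1) * (r * (r * 1) * a)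
      shuffle₁ = solve-∀
      shuffle₂ : ∀ p b e → p * (p * 1) * (b * (e * (e * 1))) ≡ b * ((p * e) * (p * e))
      shuffle₂ = solve-∀
      shuffle₃ : ∀ b k r → b * ((k * r) * (k * r)) ≡ k * (k * 1) * b * (r * (r * 1))
      shuffle₃ = solve-∀

module Residues (p : ℕ) .{{_ : NonZero p}} where

  open import Data.Nat.Base as ℕ using (_∸_)
  import Data.Nat.Properties as ℕ
  open import Data.Nat.DivMod using (_mod_; _%_; _/_; m≡m%n+[m/n]*n; m%n<n)
  open import Data.Nat.Divisibility as ℕ∣ using (∣⇒≤)
  open import Data.Nat.Primality using (Prime; euclidsLemma)
  open import Data.Fin.Base using (toℕ)
  import Data.Fin.Properties as Fin
  open import Data.Integer.Base using (ℤ; +_; _+_; _*_; -_; _-_; ∣_∣; _⊖_)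
  import Data.Integer.Properties as ℤ
  open import Data.Integer.Divisibility.Signed
    using (_∣_; divides; ∣m∣n⇒∣m+n; ∣m⇒∣-m; ∣n⇒∣m*n; ∣m⇒∣m*n; ∣⇒∣ᵤ; ∣ᵤ⇒∣)
  open import Data.Integer.Tactic.RingSolver using (solve; solve-∀)
  open import Data.List.Base using (_∷_; [])
  open import Data.Sum using ([_,_]′)
  open import Data.Empty using (⊥-elim)
  open import Relation.Nullary using (yes; no)
  open import Relation.Binary.PropositionalEquality
  open Field p

  -- Laws of the Fin p arithmetic of Defs are transported from ℤ along ⟦_⟧, which is
  -- injective modulo p (≈⇒≡).
  infix 4 _≈_
  record _≈_ (x y : ℤ) : Set where
    constructor divides-difference
    field p∣x-y : + p ∣ x - y
  open _≈_

  divides⇒≈ : ∀ {e x y} → + p ∣ e → e ≡ x - y → x ≈ y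
  divides⇒≈ p∣e e≡x-y = divides-difference (subst (+ p ∣_) e≡x-y p∣e)

  ≈-reflexive : ∀ {x y} → x ≡ y → x ≈ y
  ≈-reflexive {x} refl = divides⇒≈ (divides (+ 0) refl) (sym (ℤ.+-inverseʳ x))

  ≈-refl : ∀ {x} → x ≈ x
  ≈-refl = ≈-reflexive refl

  ≈-sym : ∀ {x y} → x ≈ y → y ≈ x
  ≈-sym {x} {y} x≈y = divides⇒≈ (∣m⇒∣-m (p∣x-y x≈y)) (solve (x ∷ y ∷ []))

  ≈-trans : ∀ {x y z} → x ≈ y → y ≈ z → x ≈ z
  ≈-trans {x} {y} {z} x≈y y≈z = divides⇒≈ (∣m∣n⇒∣m+n (p∣x-y x≈y) (p∣x-y y≈z)) (solve (x ∷ y ∷ z ∷ []))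

  +-cong : ∀ {x x′ y y′} → x ≈ x′ → y ≈ y′ → x + y ≈ x′ + y′
  +-cong {x} {x′} {y} {y′} x≈x′ y≈y′ = divides⇒≈ (∣m∣n⇒∣m+n (p∣x-y x≈x′) (p∣x-y y≈y′)) (solve (x ∷ x′ ∷ y ∷ y′ ∷ []))

  *-cong : ∀ {x x′ y y′} → x ≈ x′ → y ≈ y′ → x * y ≈ x′ * y′
  *-cong {x} {x′} {y} {y′} x≈x′ y≈y′ =
    divides⇒≈ (∣m∣n⇒∣m+n (∣n⇒∣m*n x (p∣x-y y≈y′)) (∣m⇒∣m*n y′ (p∣x-y x≈x′))) (solve (x ∷ x′ ∷ y ∷ y′ ∷ []))

  neg-cong : ∀ {x x′} → x ≈ x′ → - x ≈ - x′
  neg-cong {x} {x′} x≈x′ = divides⇒≈ (∣m⇒∣-m (p∣x-y x≈x′)) (solve (x ∷ x′ ∷ []))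

  p≈0 : + p ≈ + 0
  p≈0 = divides⇒≈ (divides (+ 1) (sym (ℤ.*-identityˡ (+ p)))) (sym (ℤ.+-identityʳ (+ p)))

  ⟦_⟧ : F → ℤ
  ⟦ a ⟧ = + toℕ a

  ⟦mod⟧ : ∀ m → ⟦ m mod p ⟧ ≈ + m
  ⟦mod⟧ m = divides⇒≈ (divides (- + (m / p)) (cancel (+ (m % p)) (+ (m / p)) (+ p))) (cong₂ _-_ ⟦m-mod-p⟧ m-divmod)
    where
      cancel : ∀ r q P → r - (r + q * P) ≡ - q * P
      cancel = solve-∀
      ⟦m-mod-p⟧ : + (m % p) ≡ ⟦ m mod p ⟧
      ⟦m-mod-p⟧ = cong +_ (sym (Fin.toℕ-fromℕ< (m%n<n m p)))
      m-divmod : + (m % p) + + (m / p) * + p ≡ + m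
      m-divmod = sym (trans (cong +_ (m≡m%n+[m/n]*n m p))
                            (trans (ℤ.pos-+ (m % p) _) (cong (_+_ (+ (m % p))) (ℤ.pos-* (m / p) p))))

  ⟦+⟧ : ∀ a b {X Y} → ⟦ a ⟧ ≈ X → ⟦ b ⟧ ≈ Y → ⟦ a +F b ⟧ ≈ X + Y
  ⟦+⟧ a b a≈X b≈Y = ≈-trans (⟦mod⟧ (toℕ a ℕ.+ toℕ b)) (≈-trans (≈-reflexive (ℤ.pos-+ (toℕ a) (toℕ b))) (+-cong a≈X b≈Y))

  ⟦*⟧ : ∀ a b {X Y} → ⟦ a ⟧ ≈ X → ⟦ b ⟧ ≈ Y → ⟦ a *F b ⟧ ≈ X * Y
  ⟦*⟧ a b a≈X b≈Y = ≈-trans (⟦mod⟧ (toℕ a ℕ.* toℕ b)) (≈-trans (≈-reflexive (ℤ.pos-* (toℕ a) (toℕ b))) (*-cong a≈X b≈Y))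

  ⟦neg⟧ : ∀ a {X} → ⟦ a ⟧ ≈ X → ⟦ -F a ⟧ ≈ - X
  ⟦neg⟧ a a≈X = ≈-trans (⟦mod⟧ (p ∸ toℕ a)) (≈-trans (≈-reflexive p∸a≡p-a)
                  (≈-trans (+-cong p≈0 (neg-cong a≈X)) (≈-reflexive (ℤ.+-identityˡ _))))
    where
      p∸a≡p-a : + (p ∸ toℕ a) ≡ + p - ⟦ a ⟧
      p∸a≡p-a = trans (sym (ℤ.⊖-≥ (ℕ.<⇒≤ (Fin.toℕ<n a)))) (sym (ℤ.m-n≡m⊖n p (toℕ a)))

  ⟦-⟧ : ∀ a b {X Y} → ⟦ a ⟧ ≈ X → ⟦ b ⟧ ≈ Y → ⟦ a -F b ⟧ ≈ X - Y
  ⟦-⟧ a b a≈X b≈Y = ⟦+⟧ a (-F b) a≈X (⟦neg⟧ b b≈Y)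

  ⟦0⟧ : ⟦ 0F ⟧ ≈ + 0
  ⟦0⟧ = ⟦mod⟧ 0

  ≈⇒≡ : ∀ {a b} → ⟦ a ⟧ ≈ ⟦ b ⟧ → a ≡ b
  ≈⇒≡ {a} {b} (divides-difference p∣a-b) with ∣ ⟦ a ⟧ - ⟦ b ⟧ ∣ ℕ.≟ 0
  ... | yes ∣a-b∣≡0 = Fin.toℕ-injective (ℤ.+-injective (ℤ.i-j≡0⇒i≡j _ _ (ℤ.∣i∣≡0⇒i≡0 ∣a-b∣≡0)))
  ... | no  ∣a-b∣≢0 = ⊥-elim (ℕ.<⇒≱ ∣a-b∣<p (∣⇒≤ {{ℕ.≢-nonZero ∣a-b∣≢0}} (∣⇒∣ᵤ p∣a-b)))
    where
      ∣a-b∣<p : ∣ ⟦ a ⟧ - ⟦ b ⟧ ∣ ℕ.< p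
      ∣a-b∣<p = begin-strict
        ∣ ⟦ a ⟧ - ⟦ b ⟧ ∣        ≡⟨ cong ∣_∣ (ℤ.[+m]-[+n]≡m⊖n (toℕ a) (toℕ b)) ⟩
        ∣ toℕ a ⊖ toℕ b ∣      ≤⟨ ℤ.∣m⊝n∣≤m⊔n (toℕ a) (toℕ b) ⟩
        toℕ a ℕ.⊔ toℕ b          <⟨ ℕ.⊔-lub (Fin.toℕ<n a) (Fin.toℕ<n b) ⟩
        p                        ∎
        where open ℕ.≤-Reasoning

  F-≡ : ∀ {a b X Y} → ⟦ a ⟧ ≈ X → ⟦ b ⟧ ≈ Y → X ≡ Y → a ≡ b
  F-≡ a≈X b≈Y X≡Y = ≈⇒≡ (≈-trans a≈X (≈-trans (≈-reflexive X≡Y) (≈-sym b≈Y)))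

  *F-cancelʳ : Prime p → ∀ {a b c} → c ≢ 0F → a *F c ≡ b *F c → a ≡ b
  *F-cancelʳ p-prime {a} {b} {c} c≢0 ac≡bc =
    [ (λ p∣a-b → ≈⇒≡ (divides-difference (∣ᵤ⇒∣ p∣a-b))) , (λ p∣c → ⊥-elim (c≢0 (c≡0 p∣c))) ]′
      (euclidsLemma ∣ ⟦ a ⟧ - ⟦ b ⟧ ∣ (toℕ c) p-prime p∣∣a-b∣c)
    where
      ac≈bc : ⟦ a ⟧ * ⟦ c ⟧ ≈ ⟦ b ⟧ * ⟦ c ⟧
      ac≈bc = ≈-trans (≈-sym (⟦*⟧ a c ≈-refl ≈-refl)) (≈-trans (≈-reflexive (cong ⟦_⟧ ac≡bc)) (⟦*⟧ b c ≈-refl ≈-refl))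
      factor : ∀ a b c → a * c - b * c ≡ (a - b) * c
      factor = solve-∀
      p∣∣a-b∣c : p ℕ∣.∣ ∣ ⟦ a ⟧ - ⟦ b ⟧ ∣ ℕ.* toℕ c
      p∣∣a-b∣c = subst (p ℕ∣.∣_) (trans (cong ∣_∣ (factor ⟦ a ⟧ ⟦ b ⟧ ⟦ c ⟧)) (ℤ.abs-* (⟦ a ⟧ - ⟦ b ⟧) ⟦ c ⟧))
                       (∣⇒∣ᵤ (p∣x-y ac≈bc))
      c≡0 : p ℕ∣.∣ toℕ c → c ≡ 0F
      c≡0 p∣c = ≈⇒≡ (≈-trans (divides⇒≈ (∣ᵤ⇒∣ {i = ⟦ c ⟧} p∣c) (sym (ℤ.+-identityʳ ⟦ c ⟧))) (≈-sym ⟦0⟧))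

  +F-identityˡ : ∀ a → 0F +F a ≡ a
  +F-identityˡ a = F-≡ (⟦+⟧ 0F a ⟦0⟧ ≈-refl) ≈-refl (ℤ.+-identityˡ ⟦ a ⟧)

  +F-identityʳ : ∀ a → a +F 0F ≡ a
  +F-identityʳ a = F-≡ (⟦+⟧ a 0F ≈-refl ⟦0⟧) ≈-refl (ℤ.+-identityʳ ⟦ a ⟧)

  +F-assoc : ∀ a b c → (a +F b) +F c ≡ a +F (b +F c)
  +F-assoc a b c = F-≡ (⟦+⟧ (a +F b) c (⟦+⟧ a b ≈-refl ≈-refl) ≈-refl) (⟦+⟧ a (b +F c) ≈-refl (⟦+⟧ b c ≈-refl ≈-refl))
                       (ℤ.+-assoc ⟦ a ⟧ ⟦ b ⟧ ⟦ c ⟧)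

  ≈-cancelˡ : ∀ a {x y} → a + x ≈ a + y → x ≈ y
  ≈-cancelˡ a {x} {y} ax≈ay = divides⇒≈ (p∣x-y ax≈ay) (solve (a ∷ x ∷ y ∷ []))

  ⟦⟧-cong : ∀ {a b} → a ≡ b → ⟦ a ⟧ ≈ ⟦ b ⟧
  ⟦⟧-cong a≡b = ≈-reflexive (cong ⟦_⟧ a≡b)

  +F-comm : ∀ a b → a +F b ≡ b +F a
  +F-comm a b = F-≡ (⟦+⟧ a b ≈-refl ≈-refl) (⟦+⟧ b a ≈-refl ≈-refl) (ℤ.+-comm ⟦ a ⟧ ⟦ b ⟧)

  +F-cancelˡ : ∀ a {b c} → a +F b ≡ a +F c → b ≡ c
  +F-cancelˡ a {b} {c} ab≡ac =
    ≈⇒≡ (≈-cancelˡ ⟦ a ⟧ (≈-trans (≈-sym (⟦+⟧ a b ≈-refl ≈-refl)) (≈-trans (⟦⟧-cong ab≡ac) (⟦+⟧ a c ≈-refl ≈-refl))))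

  +F-cancelʳ : ∀ a {b c} → b +F a ≡ c +F a → b ≡ c
  +F-cancelʳ a {b} {c} ba≡ca = +F-cancelˡ a (trans (+F-comm a b) (trans ba≡ca (+F-comm c a)))

  -F-cancelˡ : ∀ a {b c} → a -F b ≡ a -F c → b ≡ c
  -F-cancelˡ a {b} {c} a-b≡a-c = ≈⇒≡ (≈-trans (≈-reflexive (sym (ℤ.neg-involutive ⟦ b ⟧)))
    (≈-trans (neg-cong (≈-cancelˡ ⟦ a ⟧ (≈-trans (≈-sym (⟦-⟧ a b ≈-refl ≈-refl)) (≈-trans (⟦⟧-cong a-b≡a-c) (⟦-⟧ a c ≈-refl ≈-refl)))))
             (≈-reflexive (ℤ.neg-involutive ⟦ c ⟧))))

  -F-0*F : ∀ a b → a -F (0F *F b) ≡ a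
  -F-0*F a b = F-≡ (⟦-⟧ a (0F *F b) ≈-refl (⟦*⟧ 0F b ⟦0⟧ ≈-refl)) ≈-refl
                   (trans (cong (λ t → ⟦ a ⟧ - t) (ℤ.*-zeroˡ ⟦ b ⟧)) (ℤ.+-identityʳ ⟦ a ⟧))

  -F-*F-distrib : ∀ x y l l′ c → (x +F y) -F ((l +F l′) *F c) ≡ (x -F (l *F c)) +F (y -F (l′ *F c))
  -F-*F-distrib x y l l′ c = F-≡
    (⟦-⟧ (x +F y) ((l +F l′) *F c) (⟦+⟧ x y ≈-refl ≈-refl) (⟦*⟧ (l +F l′) c (⟦+⟧ l l′ ≈-refl ≈-refl) ≈-refl))
    (⟦+⟧ (x -F (l *F c)) (y -F (l′ *F c)) (⟦-⟧ x (l *F c) ≈-refl (⟦*⟧ l c ≈-refl ≈-refl))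
                                          (⟦-⟧ y (l′ *F c) ≈-refl (⟦*⟧ l′ c ≈-refl ≈-refl)))
    (regroup ⟦ x ⟧ ⟦ y ⟧ ⟦ l ⟧ ⟦ l′ ⟧ ⟦ c ⟧)
    where
      regroup : ∀ x y l l′ c → (x + y) - (l + l′) * c ≡ (x - l * c) + (y - l′ * c)
      regroup = solve-∀

module Horner (p : ℕ) .{{_ : NonZero p}} where

  open import Data.Nat.Base as ℕ using (zero; suc; _≤_; z≤n; s≤s)
  import Data.Nat.Properties as ℕ
  open import Data.Nat.Primality using (Prime)
  open import Data.Vec.Base using (Vec; []; _∷_; _∷ʳ_; zipWith; replicate; toList; initLast; init; last)
  open import Data.Vec.Properties using (∷-injective; zipWith-identityʳ; toList-∷ʳ; init-∷ʳ; last-∷ʳ)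
  import Data.List.Base as List
  import Data.List.Properties as List
  open import Data.Product using (_×_; _,_; proj₁; proj₂)
  open import Data.Unit using (⊤; tt)
  open import Relation.Binary.PropositionalEquality
  open Field p
  open Residues p

  infixl 6 _⊕_
  _⊕_ : ∀ {n} → Vec F n → Vec F n → Vec F n
  _⊕_ = zipWith _+F_

  0V : ∀ {n} → Vec F n
  0V = replicate _ 0F

  ⊕-identityʳ : ∀ {n} (x : Vec F n) → x ⊕ 0V ≡ x
  ⊕-identityʳ = zipWith-identityʳ +F-identityʳ

  ⊕-cancelˡ : ∀ {n} (x : Vec F n) {y y′} → x ⊕ y ≡ x ⊕ y′ → y ≡ y′
  ⊕-cancelˡ []       {[]}     {[]}       _   = refl
  ⊕-cancelˡ (x ∷ xs) {y ∷ ys} {y′ ∷ ys′} eq =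
    cong₂ _∷_ (+F-cancelˡ x (proj₁ (∷-injective eq))) (⊕-cancelˡ xs (proj₂ (∷-injective eq)))

  init∷ʳlast : ∀ {n} (r : Vec F (suc n)) → init r ∷ʳ last r ≡ r
  init∷ʳlast r with initLast r
  ... | _ , _ , refl = refl

  ∷ʳ-⊕ : ∀ {n} (xs ys : Vec F n) a b → (xs ∷ʳ a) ⊕ (ys ∷ʳ b) ≡ (xs ⊕ ys) ∷ʳ (a +F b)
  ∷ʳ-⊕ []       []       a b = refl
  ∷ʳ-⊕ (x ∷ xs) (y ∷ ys) a b = cong (x +F y ∷_) (∷ʳ-⊕ xs ys a b)

  ⊕-init∷ʳlast : ∀ {n} (x y : Vec F (suc n)) → x ⊕ y ≡ (init x ⊕ init y) ∷ʳ (last x +F last y)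
  ⊕-init∷ʳlast x y = trans (sym (cong₂ _⊕_ (init∷ʳlast x) (init∷ʳlast y))) (∷ʳ-⊕ (init x) (init y) (last x) (last y))

  init-⊕ : ∀ {n} (x y : Vec F (suc n)) → init (x ⊕ y) ≡ init x ⊕ init y
  init-⊕ x y = trans (cong init (⊕-init∷ʳlast x y)) (init-∷ʳ (last x +F last y) (init x ⊕ init y))

  last-⊕ : ∀ {n} (x y : Vec F (suc n)) → last (x ⊕ y) ≡ last x +F last y
  last-⊕ x y = trans (cong last (⊕-init∷ʳlast x y)) (last-∷ʳ (last x +F last y) (init x ⊕ init y))

  addConst-⊕ : ∀ {n} a (x y : Vec F n) → addConst a (x ⊕ y) ≡ x ⊕ addConst a y
  addConst-⊕ a []       []       = refl
  addConst-⊕ a (x ∷ xs) (y ∷ ys) = cong (_∷ (xs ⊕ ys)) (+F-assoc x y a)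

  addConst-injective : ∀ {n} a {x y : Vec F n} → addConst a x ≡ addConst a y → x ≡ y
  addConst-injective a {[]}     {[]}     _  = refl
  addConst-injective a {x ∷ xs} {y ∷ ys} eq = cong₂ _∷_ (+F-cancelʳ a (proj₁ (∷-injective eq))) (proj₂ (∷-injective eq))

  subScaled : ∀ {n} → F → Vec F n → Vec F n → Vec F n
  subScaled l = zipWith (λ s t → s -F (l *F t))

  subScaled-⊕ : ∀ {n} l l′ (u v w : Vec F n) → subScaled (l +F l′) (u ⊕ v) w ≡ subScaled l u w ⊕ subScaled l′ v w
  subScaled-⊕ l l′ []       []       []       = refl
  subScaled-⊕ l l′ (u ∷ us) (v ∷ vs) (w ∷ ws) = cong₂ _∷_ (-F-*F-distrib u v l l′ w) (subScaled-⊕ l l′ us vs ws)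

  subScaled-0 : ∀ {n} (u w : Vec F n) → subScaled 0F u w ≡ u
  subScaled-0 []       []       = refl
  subScaled-0 (u ∷ us) (w ∷ ws) = cong₂ _∷_ (-F-0*F u w) (subScaled-0 us ws)

  subScaled-injective : ∀ {n} l {u u′ : Vec F n} w → subScaled l u w ≡ subScaled l u′ w → u ≡ u′
  subScaled-injective l {[]}     {[]}       []       _  = refl
  subScaled-injective l {u ∷ us} {u′ ∷ us′} (w ∷ ws) eq =
    cong₂ _∷_ (+F-cancelʳ (-F (l *F w)) (proj₁ (∷-injective eq))) (subScaled-injective l ws (proj₂ (∷-injective eq)))

  -- r = (r₀, …, r_{n-1}) read as r₀ + r₁x + …, as in Defs.
  DegreeBelow : ∀ {n} → ℕ → Vec F n → Set
  DegreeBelow _       []       = ⊤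
  DegreeBelow zero    (r ∷ rs) = r ≡ 0F × DegreeBelow zero rs
  DegreeBelow (suc k) (r ∷ rs) = DegreeBelow k rs

  0V-degreeBelow : ∀ {n} k → DegreeBelow k (0V {n})
  0V-degreeBelow {zero}  _       = tt
  0V-degreeBelow {suc n} zero    = refl , 0V-degreeBelow {n} zero
  0V-degreeBelow {suc n} (suc k) = 0V-degreeBelow {n} k

  degreeBelow-∷ʳ : ∀ {n k} → k ≤ n → (rs : Vec F n) {a : F} →
                   DegreeBelow k (rs ∷ʳ a) → DegreeBelow k rs × a ≡ 0F
  degreeBelow-∷ʳ z≤n       []       (a≡0 , _) = tt , a≡0
  degreeBelow-∷ʳ z≤n       (r ∷ rs) (r≡0 , h) = let h′ , a≡0 = degreeBelow-∷ʳ z≤n rs h in (r≡0 , h′) , a≡0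
  degreeBelow-∷ʳ (s≤s k≤n) (r ∷ rs) h         = degreeBelow-∷ʳ k≤n rs h

  degreeBelow-init : ∀ {n k} → k ≤ n → (r : Vec F (suc n)) →
                     DegreeBelow k r → DegreeBelow k (init r) × last r ≡ 0F
  degreeBelow-init k≤n r h = degreeBelow-∷ʳ k≤n (init r) (subst (DegreeBelow _) (sym (init∷ʳlast r)) h)

  module _ {d} (c : Vec F (suc d)) where

    reduceFrom : ∀ {k} → Vec F (suc d) → Vec F k → Vec F (suc d)
    reduceFrom z b = List.foldl (step c) z (toList b)

    mulX^ : ℕ → Vec F (suc d) → Vec F (suc d)
    mulX^ zero    r = r
    mulX^ (suc k) r = mulX^ k (mulX c r)

    mulX-⊕ : ∀ x y → mulX c (x ⊕ y) ≡ mulX c x ⊕ mulX c y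
    mulX-⊕ x y = begin
      subScaled (last (x ⊕ y)) (0F ∷ init (x ⊕ y)) c
        ≡⟨ cong₂ (λ l ys → subScaled l (0F ∷ ys) c) (last-⊕ x y) (init-⊕ x y) ⟩
      subScaled (last x +F last y) (0F ∷ (init x ⊕ init y)) c
        ≡⟨ cong (λ z → subScaled (last x +F last y) (z ∷ (init x ⊕ init y)) c) (+F-identityʳ 0F) ⟨
      subScaled (last x +F last y) ((0F ∷ init x) ⊕ (0F ∷ init y)) c
        ≡⟨ subScaled-⊕ (last x) (last y) (0F ∷ init x) (0F ∷ init y) c ⟩
      mulX c x ⊕ mulX c y ∎
      where open ≡-Reasoning

    step-⊕ : ∀ x y a → step c (x ⊕ y) a ≡ mulX c x ⊕ step c y a
    step-⊕ x y a = trans (cong (addConst a) (mulX-⊕ x y)) (addConst-⊕ a (mulX c x) (mulX c y))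

    reduceFrom-⊕ : ∀ {k} x y (b : Vec F k) → reduceFrom (x ⊕ y) b ≡ mulX^ k x ⊕ reduceFrom y b
    reduceFrom-⊕ x y []      = refl
    reduceFrom-⊕ x y (a ∷ b) = trans (cong (λ z → reduceFrom z b) (step-⊕ x y a)) (reduceFrom-⊕ (mulX c x) (step c y a) b)

    reduceFrom-split : ∀ {k} z (b : Vec F k) → reduceFrom z b ≡ mulX^ k z ⊕ reduceFrom 0V b
    reduceFrom-split z b = trans (cong (λ w → reduceFrom w b) (sym (⊕-identityʳ z))) (reduceFrom-⊕ z 0V b)

    reduceFrom-∷ʳ : ∀ {k} z (bs : Vec F k) a → reduceFrom z (bs ∷ʳ a) ≡ step c (reduceFrom z bs) a
    reduceFrom-∷ʳ z bs a = trans (cong (List.foldl (step c) z) (toList-∷ʳ a bs)) (List.foldl-∷ʳ (step c) z a (toList bs))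

    step-degreeBelow : ∀ {k} → k ≤ d → ∀ {r} → DegreeBelow k r → ∀ a → step c r a ≡ a ∷ init r
    step-degreeBelow k≤d {r} h a = begin
      addConst a (subScaled (last r) (0F ∷ init r) c)
        ≡⟨ cong (λ l → addConst a (subScaled l (0F ∷ init r) c)) (proj₂ (degreeBelow-init k≤d r h)) ⟩
      addConst a (subScaled 0F (0F ∷ init r) c)         ≡⟨ cong (addConst a) (subScaled-0 (0F ∷ init r) c) ⟩
      (0F +F a) ∷ init r                                ≡⟨ cong (_∷ init r) (+F-identityˡ a) ⟩
      a ∷ init r                                        ∎
      where open ≡-Reasoning

    reduce-∷ʳ : ∀ {k} → k ≤ d → (bs : Vec F k) (a : F) → reduceFrom 0V (bs ∷ʳ a) ≡ a ∷ init (reduceFrom 0V bs)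
    reduce-degreeBelow : ∀ {k} → k ≤ suc d → (b : Vec F k) → DegreeBelow k (reduceFrom 0V b)

    reduce-∷ʳ k≤d bs a = trans (reduceFrom-∷ʳ 0V bs a) (step-degreeBelow k≤d (reduce-degreeBelow (ℕ.m≤n⇒m≤1+n k≤d) bs) a)

    reduce-degreeBelow {zero}  _         [] = 0V-degreeBelow {suc d} zero
    reduce-degreeBelow {suc k} (s≤s k≤d) b with initLast b
    ... | bs , a , refl = subst (DegreeBelow (suc k)) (sym (reduce-∷ʳ k≤d bs a))
                                (proj₁ (degreeBelow-init k≤d _ (reduce-degreeBelow (ℕ.m≤n⇒m≤1+n k≤d) bs)))

    reduce-injective : ∀ {k} → k ≤ suc d → (b b′ : Vec F k) → reduceFrom 0V b ≡ reduceFrom 0V b′ → b ≡ b′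
    reduce-injective {zero}  _         []  []  _  = refl
    reduce-injective {suc k} (s≤s k≤d) b   b′  eq with initLast b | initLast b′
    ... | bs , a , refl | bs′ , a′ , refl =
      cong₂ _∷ʳ_ (reduce-injective (ℕ.m≤n⇒m≤1+n k≤d) bs bs′ (begin
                   reduceFrom 0V bs                      ≡⟨ init∷ʳ0 bs ⟨
                   init (reduceFrom 0V bs) ∷ʳ 0F         ≡⟨ cong (_∷ʳ 0F) (proj₂ (∷-injective heads-tails)) ⟩
                   init (reduceFrom 0V bs′) ∷ʳ 0F        ≡⟨ init∷ʳ0 bs′ ⟩
                   reduceFrom 0V bs′                     ∎))
                 (proj₁ (∷-injective heads-tails))
      where
        open ≡-Reasoning
        heads-tails : a ∷ init (reduceFrom 0V bs) ≡ a′ ∷ init (reduceFrom 0V bs′)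
        heads-tails = trans (sym (reduce-∷ʳ k≤d bs a)) (trans eq (reduce-∷ʳ k≤d bs′ a′))
        init∷ʳ0 : (bs : Vec F k) → init (reduceFrom 0V bs) ∷ʳ 0F ≡ reduceFrom 0V bs
        init∷ʳ0 bs = trans (cong (init (reduceFrom 0V bs) ∷ʳ_)
                                 (sym (proj₂ (degreeBelow-init k≤d _ (reduce-degreeBelow (ℕ.m≤n⇒m≤1+n k≤d) bs)))))
                           (init∷ʳlast (reduceFrom 0V bs))

    reduceFrom-injective : ∀ z (b b′ : Vec F (suc d)) → reduceFrom z b ≡ reduceFrom z b′ → b ≡ b′
    reduceFrom-injective z b b′ eq = reduce-injective ℕ.≤-refl b b′
      (⊕-cancelˡ (mulX^ (suc d) z) (trans (sym (reduceFrom-split z b)) (trans eq (reduceFrom-split z b′))))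

    module _ (p-prime : Prime p) (x∤u : XNotDivides c) where

      mulX-injective : ∀ {r r′} → mulX c r ≡ mulX c r′ → r ≡ r′
      mulX-injective {r} {r′} eq =
        trans (sym (init∷ʳlast r)) (trans (cong₂ _∷ʳ_ init≡ last≡) (init∷ʳlast r′))
        where
          last-and-init : ∀ (c : Vec F (suc d)) → XNotDivides c →
                           subScaled (last r) (0F ∷ init r) c ≡ subScaled (last r′) (0F ∷ init r′) c →
                           last r ≡ last r′ × init r ≡ init r′
          last-and-init (c₀ ∷ cs) c₀≢0 eq′ = l≡l′ , subScaled-injective (last r) cs
              (trans (proj₂ (∷-injective eq′)) (cong (λ l → subScaled l (init r′) cs) (sym l≡l′)))
            where
              l≡l′ = *F-cancelʳ p-prime c₀≢0 (-F-cancelˡ 0F (proj₁ (∷-injective eq′)))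
          last≡ = proj₁ (last-and-init c x∤u eq)
          init≡ = proj₂ (last-and-init c x∤u eq)

      step-injective : ∀ a {r r′} → step c r a ≡ step c r′ a → r ≡ r′
      step-injective a eq = mulX-injective (addConst-injective a eq)

module Walks (p : ℕ) .{{_ : NonZero p}} {d : ℕ} (c : Vec (Fin p) (suc d)) where

  open import Data.Nat.Base as ℕ using (zero; _∸_)
  import Data.Nat.Properties as ℕ
  import Data.Fin.Properties as Fin
  open import Data.Vec.Properties using (≡-dec)
  open import Data.Integer.Base using (ℤ; +_; _*_; _-_; _≤_; +≤+; nonNegative)
  import Data.Integer.Properties as ℤ
  open import Data.Integer.Tactic.RingSolver using (solve-∀)
  open import Algebra.Properties.Semiring.Sum ℤ.+-*-semiring using (sum; sum-cong-≗)
  open import Relation.Binary.PropositionalEquality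
  open Field p
  open Summations
  open Horner p

  D : ℕ
  D = suc d

  V : Set
  V = Vec F D

  residueSum : Summation V
  residueSum = vecSum p D

  ∑ᵥ : (V → ℤ) → ℤ
  ∑ᵥ = ∑ residueSum

  nonzero : F → ℤ
  nonzero a = + 1 - δᶠ a 0F

  nonzeroSum : Summation F
  nonzeroSum = weightedSum (finSum p) nonzero (λ a → ℤ.i≤j⇒0≤j-i (δ≤1 Fin._≟_ a 0F))

  ∑* : (F → ℤ) → ℤ
  ∑* = ∑ nonzeroSum

  ∑*-const : ∀ k → ∑* (λ _ → k) ≡ + (p ∸ 1) * k
  ∑*-const k = begin
    sum {p} (λ a → (+ 1 - δᶠ a 0F) * k)
      ≡⟨ sum-cong-≗ {p} (λ a → trans (split (δᶠ a 0F) k) (cong (λ t → k - t * k) (δ-sym Fin._≟_ a 0F))) ⟩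
    sum {p} (λ a → k - δᶠ 0F a * k)
      ≡⟨ ∑-- (finSum p) (λ _ → k) (λ a → δᶠ 0F a * k) ⟩
    sum {p} (λ _ → k) - sum {p} (λ a → δᶠ 0F a * k)
      ≡⟨ cong₂ _-_ (sum-const p k) (∑ᶠ-δ 0F (λ _ → k)) ⟩
    + p * k - k
      ≡⟨ collect (+ p) k ⟩
    (+ p - + 1) * k
      ≡⟨ cong (_* k) p-1≡p∸1 ⟩
    + (p ∸ 1) * k ∎
    where
      open ≡-Reasoning
      split : ∀ δ k → (+ 1 - δ) * k ≡ k - δ * k
      split = solve-∀
      collect : ∀ p k → p * k - k ≡ (p - + 1) * k
      collect = solve-∀
      p-1≡p∸1 : + p - + 1 ≡ + (p ∸ 1)
      p-1≡p∸1 = trans (ℤ.m-n≡m⊖n p 1) (ℤ.⊖-≥ (ℕ.>-nonZero⁻¹ p))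

  P : ℕ → ℤ
  P n = + ((p ∸ 1) ℕ.^ n)

  P-+ : ∀ m n → P (m ℕ.+ n) ≡ P m * P n
  P-+ m n = trans (cong +_ (ℕ.^-distribˡ-+-* (p ∸ 1) m n)) (ℤ.pos-* ((p ∸ 1) ℕ.^ m) ((p ∸ 1) ℕ.^ n))

  walks : ℕ → V → V → ℤ
  walks zero    z α = δᵛ z α
  walks (suc n) z α = ∑* (λ a → walks n (step c z a) α)

  walks-nonNeg : ∀ n z α → + 0 ≤ walks n z α
  walks-nonNeg zero    z α = δ-nonNeg (≡-dec Fin._≟_) z α
  walks-nonNeg (suc n) z α = ∑-nonNeg nonzeroSum (λ a → walks-nonNeg n (step c z a) α)

  ∑-walks-target : ∀ n z → ∑ᵥ (walks n z) ≡ P n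
  ∑-walks-target zero    z = ∑ᵛ-δ-row z
  ∑-walks-target (suc n) z = begin
    ∑ᵥ (λ α → ∑* (λ a → walks n (step c z a) α))
      ≡⟨ ∑-comm-vecSum nonzeroSum p D (λ a α → walks n (step c z a) α) ⟨
    ∑* (λ a → ∑ᵥ (walks n (step c z a)))
      ≡⟨ ∑-cong nonzeroSum (λ a → ∑-walks-target n (step c z a)) ⟩
    ∑* (λ _ → P n)
      ≡⟨ ∑*-const (P n) ⟩
    + (p ∸ 1) * P n
      ≡⟨ ℤ.pos-* (p ∸ 1) _ ⟨
    P (suc n) ∎
    where open ≡-Reasoning

  walks-+ : ∀ m n z α → walks (m ℕ.+ n) z α ≡ ∑ᵥ (λ w → walks m z w * walks n w α)
  walks-+ zero    n z α = sym (∑ᵛ-δ z (λ w → walks n w α))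
  walks-+ (suc m) n z α = begin
    ∑* (λ a → walks (m ℕ.+ n) (step c z a) α)
      ≡⟨ ∑-cong nonzeroSum (λ a → walks-+ m n (step c z a) α) ⟩
    ∑* (λ a → ∑ᵥ (λ w → walks m (step c z a) w * walks n w α))
      ≡⟨ ∑-comm-vecSum nonzeroSum p D (λ a w → walks m (step c z a) w * walks n w α) ⟩
    ∑ᵥ (λ w → ∑* (λ a → walks m (step c z a) w * walks n w α))
      ≡⟨ ∑-cong residueSum (λ w → ∑-*ʳ nonzeroSum (walks n w α) (λ a → walks m (step c z a) w)) ⟩
    ∑ᵥ (λ w → walks (suc m) z w * walks n w α) ∎
    where open ≡-Reasoning

  walks≤reductions : ∀ k z w → walks k z w ≤ ∑ (vecSum p k) (λ b → δᵛ (reduceFrom c z b) w)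
  walks≤reductions zero    z w = ℤ.≤-refl
  walks≤reductions (suc k) z w = ∑-mono-≤ (finSum p) (λ a → ℤ.≤-trans (drop-weight a) (walks≤reductions k (step c z a) w))
    where
      drop-weight : ∀ a → nonzero a * walks k (step c z a) w ≤ walks k (step c z a) w
      drop-weight a = subst (nonzero a * walks k (step c z a) w ≤_) (ℤ.*-identityˡ _)
        (ℤ.*-monoʳ-≤-nonNeg (walks k (step c z a) w) {{nonNegative (walks-nonNeg k (step c z a) w)}}
                            (ℤ.i-j≤i (+ 1) (δᶠ a 0F) {{nonNegative (δ-nonNeg Fin._≟_ a 0F)}}))

  walks-D≤1 : ∀ z w → walks D z w ≤ + 1
  walks-D≤1 z w = ℤ.≤-trans (walks≤reductions D z w)
    (fibre-size≤1 (≡-dec Fin._≟_) (reduceFrom c z) (λ {b} {b′} → reduceFrom-injective c z b b′) w)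

  walks-D-idempotent : ∀ z w → walks D z w * walks D z w ≡ walks D z w
  walks-D-idempotent z w = idempotent (walks-nonNeg D z w) (walks-D≤1 z w)
    where
      idempotent : ∀ {x} → + 0 ≤ x → x ≤ + 1 → x * x ≡ x
      idempotent {+ 0}       _ _                     = refl
      idempotent {+ 1}       _ _                     = refl
      idempotent {+ suc (suc _)} _ (+≤+ (ℕ.s≤s ()))

module Equidistribution (p : ℕ) .{{_ : NonZero p}} (p-prime : Prime p) {d : ℕ} (c : Vec (Fin p) (suc d))
                        (x∤u : Field.XNotDivides p c) where

  open import Data.Nat.Base as ℕ using (zero; _∸_)
  import Data.Nat.Properties as ℕ
  import Data.Fin.Properties as Fin
  open import Data.Vec.Properties using (≡-dec)
  open import Data.Integer.Base using (ℤ; +_; _+_; _*_; _-_; _≤_; +≤+; _^_)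
  import Data.Integer.Properties as ℤ
  open import Data.Integer.Tactic.RingSolver using (solve-∀)
  open import Algebra.Properties.CommutativeSemigroup ℤ.*-commutativeSemigroup using (x∙yz≈y∙xz)
  open import Relation.Binary.PropositionalEquality
  open Field p
  open AbsoluteBound
  open Summations
  open Horner p
  open Walks p c

  ∑-walks-source : ∀ n α → ∑ᵥ (λ z → walks n z α) ≡ P n
  ∑-walks-source zero    α = trans (∑-cong residueSum (λ z → δ-sym (≡-dec Fin._≟_) z α)) (∑ᵛ-δ-row α)
  ∑-walks-source (suc n) α = begin
    ∑ᵥ (λ z → ∑* (λ a → walks n (step c z a) α))
      ≡⟨ ∑-comm-vecSum nonzeroSum p D (λ a z → walks n (step c z a) α) ⟨
    ∑* (λ a → ∑ᵥ (λ z → walks n (step c z a) α))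
      ≡⟨ ∑-cong nonzeroSum (λ a → ∑ᵛ-reindex (λ z → step c z a) (step-injective c p-prime x∤u a) (λ z → walks n z α)) ⟩
    ∑* (λ a → ∑ᵥ (λ z → walks n z α))
      ≡⟨ ∑-cong nonzeroSum (λ _ → ∑-walks-source n α) ⟩
    ∑* (λ _ → P n)
      ≡⟨ ∑*-const (P n) ⟩
    + (p ∸ 1) * P n
      ≡⟨ ℤ.pos-* (p ∸ 1) ((p ∸ 1) ℕ.^ n) ⟨
    P (suc n) ∎
    where open ≡-Reasoning

  Q R E : ℤ
  Q = + (p ℕ.^ D)
  R = P D
  E = Q - R

  ∑ᵥ-1 : ∑ᵥ (λ _ → + 1) ≡ Q
  ∑ᵥ-1 = trans (∑ᵛ-const p D (+ 1)) (ℤ.*-identityʳ Q)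

  mixing : ∀ z α → ∣ Q * walks (D ℕ.+ D) z α - R * R ∣≤ R * E
  mixing z α = *-cancelˡ-∣∣≤ (2 ℕ.* p ℕ.^ D) {{ℕ.m*n≢0 2 (p ℕ.^ D) {{_}} {{ℕ.m^n≢0 p D}}}}
    (subst₂ ∣_∣≤_ (trans (cong (+ 2 *_) ∑xy) (trans (twice Q (Q * walks (D ℕ.+ D) z α - R * R)) 2Q))
                  (trans (cong₂ _+_ ∑xx ∑yy) (trans (double Q R) 2Q))
                  cauchy-schwarz)
    where
      A B x y : V → ℤ
      A w = walks D z w
      B w = walks D w α
      x w = Q * A w - R
      y w = Q * B w - R
      centred : ∀ f g → ∑ᵥ f ≡ R → ∑ᵥ g ≡ R →
                ∑ᵥ (λ w → (Q * f w - R) * (Q * g w - R)) ≡ Q * (Q * ∑ᵥ (λ w → f w * g w) - R * R)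
      centred f g = ∑-centred-product residueSum Q R R f g ∑ᵥ-1
      ∑xy : ∑ᵥ (λ w → x w * y w) ≡ Q * (Q * walks (D ℕ.+ D) z α - R * R)
      ∑xy = trans (centred A B (∑-walks-target D z) (∑-walks-source D α))
                  (cong (λ t → Q * (Q * t - R * R)) (sym (walks-+ D D z α)))
      ∑-square : ∀ f → (∀ w → f w * f w ≡ f w) → ∑ᵥ f ≡ R →
                 ∑ᵥ (λ w → (Q * f w - R) * (Q * f w - R)) ≡ Q * (Q * R - R * R)
      ∑-square f idem ∑f≡R = trans (centred f f ∑f≡R ∑f≡R)
                                   (cong (λ t → Q * (Q * t - R * R)) (trans (∑-cong residueSum idem) ∑f≡R))
      ∑xx : ∑ᵥ (λ w → x w * x w) ≡ Q * (Q * R - R * R)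
      ∑xx = ∑-square A (walks-D-idempotent z) (∑-walks-target D z)
      ∑yy : ∑ᵥ (λ w → y w * y w) ≡ Q * (Q * R - R * R)
      ∑yy = ∑-square B (λ w → walks-D-idempotent w α) (∑-walks-source D α)
      cauchy-schwarz : ∣ + 2 * ∑ᵥ (λ w → x w * y w) ∣≤ ∑ᵥ (λ w → x w * x w) + ∑ᵥ (λ w → y w * y w)
      cauchy-schwarz = ∣2∑fg∣≤∑f²+∑g² residueSum x y
      2Q : ∀ {t} → + 2 * Q * t ≡ + (2 ℕ.* p ℕ.^ D) * t
      2Q {t} = cong (_* t) (sym (ℤ.pos-* 2 (p ℕ.^ D)))
      twice : ∀ Q t → + 2 * (Q * t) ≡ + 2 * Q * t
      twice = solve-∀
      double : ∀ Q R → Q * (Q * R - R * R) + Q * (Q * R - R * R) ≡ + 2 * Q * (R * (Q - R))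
      double = solve-∀

  N : ℕ → V → ℤ
  N n = walks n 0V

  -- X n α / (P n · Q) = |𝒜_n(u;α)|/(p-1)ⁿ - p^{-D}, the signed discrepancy.
  X : ℕ → V → ℤ
  X n α = Q * N n α - P n

  -- |X n α| / (P n · Q) ≤ Q⁻¹ (E/R)ʲ, with the denominators cleared.
  DiscrepancyBound : ℕ → ℕ → Set
  DiscrepancyBound n j = ∀ α → ∣ R ^ j * X n α ∣≤ P n * E ^ j

  R-nonNeg : + 0 ≤ R
  R-nonNeg = +≤+ ℕ.z≤n

  P-period : ∀ n → P (n ℕ.+ (D ℕ.+ D)) ≡ P n * (R * R)
  P-period n = trans (P-+ n (D ℕ.+ D)) (cong (P n *_) (P-+ D D))

  discrepancyBound-base : ∀ n → DiscrepancyBound (n ℕ.+ (D ℕ.+ D)) 1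
  discrepancyBound-base n α = subst₂ ∣_∣≤_
    (trans (cong (λ t → R * (Q * N (n ℕ.+ (D ℕ.+ D)) α - t)) (sym (P-period n)))
           (cong (_* X (n ℕ.+ (D ℕ.+ D)) α) (sym (ℤ.*-identityʳ R))))
    (trans (regroup R (P n) E) (cong (_* (E * + 1)) (sym (P-period n))))
    (*-monoˡ-∣∣≤ R-nonNeg (subst₂ ∣_∣≤_ ∑-lhs ∑-rhs
      (∑-∣∣≤ residueSum (λ z → *-monoˡ-∣∣≤ (walks-nonNeg n 0V z) (mixing z α)))))
    where
      ∑-lhs : ∑ᵥ (λ z → N n z * (Q * walks (D ℕ.+ D) z α - R * R)) ≡
              Q * N (n ℕ.+ (D ℕ.+ D)) α - P n * (R * R)
      ∑-lhs = trans (∑-*-affine residueSum Q (R * R) (N n) (λ z → walks (D ℕ.+ D) z α))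
                    (cong₂ (λ u v → Q * u - v) (sym (walks-+ n (D ℕ.+ D) 0V α))
                           (trans (cong (R * R *_) (∑-walks-target n 0V)) (ℤ.*-comm (R * R) (P n))))
      ∑-rhs : ∑ᵥ (λ z → N n z * (R * E)) ≡ P n * (R * E)
      ∑-rhs = trans (∑-*ʳ residueSum (R * E) (N n)) (cong (_* (R * E)) (∑-walks-target n 0V))
      regroup : ∀ R Pn E → R * (Pn * (R * E)) ≡ Pn * (R * R) * (E * + 1)
      regroup = solve-∀

  discrepancyBound-step : ∀ n j → DiscrepancyBound n j → DiscrepancyBound (n ℕ.+ (D ℕ.+ D)) (suc j)
  discrepancyBound-step n j bound α = subst₂ ∣_∣≤_
    (trans (sym (ℤ.*-assoc R (R ^ j) _))
           (cong (λ t → R ^ suc j * (Q * N (n ℕ.+ (D ℕ.+ D)) α - t)) (sym (P-period n))))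
    (trans (regroup R (P n) E (E ^ j)) (cong (_* E ^ suc j) (sym (P-period n))))
    (*-monoˡ-∣∣≤ R-nonNeg (*-cancelˡ-∣∣≤ (p ℕ.^ D) {{ℕ.m^n≢0 p D}} (subst₂ ∣_∣≤_ ∑-lhs ∑-rhs
      (∑-∣∣≤ residueSum (λ z → ∣∣≤-* (bound z) (mixing z α))))))
    where
      N′ = N (n ℕ.+ (D ℕ.+ D)) α
      ∑-lhs : ∑ᵥ (λ z → R ^ j * X n z * (Q * walks (D ℕ.+ D) z α - R * R)) ≡
              Q * (R ^ j * (Q * N′ - P n * (R * R)))
      ∑-lhs = begin
        ∑ᵥ (λ z → R ^ j * X n z * (Q * walks (D ℕ.+ D) z α - R * R))
          ≡⟨ ∑-cong residueSum (λ z → ℤ.*-assoc (R ^ j) (X n z) (Q * walks (D ℕ.+ D) z α - R * R)) ⟩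
        ∑ᵥ (λ z → R ^ j * (X n z * (Q * walks (D ℕ.+ D) z α - R * R)))
          ≡⟨ ∑-*ˡ residueSum (R ^ j) (λ z → X n z * (Q * walks (D ℕ.+ D) z α - R * R)) ⟩
        R ^ j * ∑ᵥ (λ z → X n z * (Q * walks (D ℕ.+ D) z α - R * R))
          ≡⟨ cong (R ^ j *_) (∑-centred-product residueSum Q (P n) (R * R) (N n) (λ z → walks (D ℕ.+ D) z α)
                                ∑ᵥ-1 (∑-walks-target n 0V) (trans (∑-walks-source (D ℕ.+ D) α) (P-+ D D))) ⟩
        R ^ j * (Q * (Q * ∑ᵥ (λ z → N n z * walks (D ℕ.+ D) z α) - P n * (R * R)))
          ≡⟨ cong (λ t → R ^ j * (Q * (Q * t - P n * (R * R)))) (sym (walks-+ n (D ℕ.+ D) 0V α)) ⟩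
        R ^ j * (Q * (Q * N′ - P n * (R * R)))
          ≡⟨ x∙yz≈y∙xz (R ^ j) Q (Q * N′ - P n * (R * R)) ⟩
        Q * (R ^ j * (Q * N′ - P n * (R * R)))  ∎
        where open ≡-Reasoning
      ∑-rhs : ∑ᵥ (λ _ → P n * E ^ j * (R * E)) ≡ Q * (P n * E ^ j * (R * E))
      ∑-rhs = ∑ᵛ-const p D _
      regroup : ∀ R Pn E Eʲ → R * (Pn * Eʲ * (R * E)) ≡ Pn * (R * R) * (E * Eʲ)
      regroup = solve-∀

  discrepancyBound : ∀ j r → DiscrepancyBound (r ℕ.+ suc j ℕ.* (D ℕ.+ D)) (suc j)
  discrepancyBound zero    r = subst (λ n → DiscrepancyBound n 1) (cong (r ℕ.+_) (sym (ℕ.+-identityʳ (D ℕ.+ D))))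
                                     (discrepancyBound-base r)
  discrepancyBound (suc j) r = subst (λ n → DiscrepancyBound n (suc (suc j))) shift
                                     (discrepancyBound-step (r ℕ.+ suc j ℕ.* (D ℕ.+ D)) (suc j) (discrepancyBound j r))
    where
      shift : r ℕ.+ suc j ℕ.* (D ℕ.+ D) ℕ.+ (D ℕ.+ D) ≡ r ℕ.+ suc (suc j) ℕ.* (D ℕ.+ D)
      shift = trans (ℕ.+-assoc r _ _) (cong (r ℕ.+_) (ℕ.+-comm (suc j ℕ.* (D ℕ.+ D)) (D ℕ.+ D)))

module Counting (p : ℕ) .{{_ : NonZero p}} {d : ℕ} (c : Vec (Fin p) (suc d)) where

  open import Data.Nat.Base using (zero)
  import Data.Fin.Properties as Fin
  open import Data.Vec.Base using (_∷_)
  open import Data.Vec.Properties using (≡-dec)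
  open import Data.Vec.Relation.Unary.All as All using (All; _∷_)
  open import Data.List.Base as List using (List; length; filter; concat; tabulate; allFin)
  import Data.List.Properties as List
  import Data.List.Relation.Unary.All as ListAll
  open import Data.Integer.Base using (ℤ; +_; _*_; _-_)
  import Data.Integer.Properties as ℤ
  open import Algebra.Properties.Semiring.Sum ℤ.+-*-semiring using (sum; sum-cong-≗)
  open import Data.Product using (_×_; _,_; proj₁)
  open import Relation.Nullary using (¬_; ¬?; Dec; yes; no)
  open import Relation.Nullary.Decidable using (_×-dec_)
  open import Relation.Unary using (Decidable)
  open import Relation.Binary.PropositionalEquality
  open Field p
  open Summations
  open FilterLength
  open Horner p
  open Walks p c

  Admissible : ∀ {n} → V → V → Vec F n → Set
  Admissible z α as = All (λ a → ¬ a ≡ 0F) as × reduceFrom c z as ≡ α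

  admissible? : ∀ {n} z α → Decidable (Admissible {n} z α)
  admissible? z α as = All.all? (λ a → ¬? (a Fin.≟ 0F)) as ×-dec ≡-dec Fin._≟_ (reduceFrom c z as) α

  count : ℕ → V → V → ℕ
  count n z α = length (filter (admissible? z α) (allVecs n))

  count≡walks : ∀ n z α → + count n z α ≡ walks n z α
  count≡walks zero    z α with ≡-dec Fin._≟_ z α
  ... | yes _ = refl
  ... | no  _ = refl
  count≡walks (suc n) z α = begin
    + length (filter (admissible? z α) (concat (List.map extend (allFin p))))
      ≡⟨ cong (λ xs → + length (filter (admissible? z α) (concat xs))) (List.map-tabulate (λ a → a) extend) ⟩
    + length (filter (admissible? z α) (concat (tabulate extend)))
      ≡⟨ length-filter-concat (admissible? z α) extend ⟩
    sum (λ a → + length (filter (admissible? z α) (extend a)))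
      ≡⟨ sum-cong-≗ {p} (λ a → trans (cong +_ (length-filter-map (admissible? z α) (a ∷_) (allVecs n))) (by-cases a (a Fin.≟ 0F))) ⟩
    sum (λ a → nonzero a * walks n (step c z a) α) ∎
    where
      open ≡-Reasoning
      extend : F → List (Vec F (suc n))
      extend a = List.map (a ∷_) (allVecs n)
      by-cases : ∀ a → Dec (a ≡ 0F) →
                 + length (filter (λ as → admissible? z α (a ∷ as)) (allVecs n)) ≡ nonzero a * walks n (step c z a) α
      by-cases a (yes a≡0) = begin
        + length (filter (λ as → admissible? z α (a ∷ as)) (allVecs n))
          ≡⟨ cong (λ xs → + length xs) (List.filter-none _ (ListAll.universal (λ _ adm → All.head (proj₁ adm) a≡0) (allVecs n))) ⟩
        + 0
          ≡⟨ ℤ.*-zeroˡ (walks n (step c z a) α) ⟨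
        + 0 * walks n (step c z a) α
          ≡⟨ cong (λ t → (+ 1 - t) * walks n (step c z a) α) (δ-≡ Fin._≟_ a≡0) ⟨
        nonzero a * walks n (step c z a) α ∎
      by-cases a (no a≢0) = begin
        + length (filter (λ as → admissible? z α (a ∷ as)) (allVecs n))
          ≡⟨ cong (λ xs → + length xs) (List.filter-≐ _ (admissible? (step c z a) α)
                                          ((λ (nz , eq) → All.tail nz , eq) , (λ (nz , eq) → a≢0 ∷ nz , eq)) (allVecs n)) ⟩
        + count n (step c z a) α
          ≡⟨ count≡walks n (step c z a) α ⟩
        walks n (step c z a) α
          ≡⟨ ℤ.*-identityˡ _ ⟨
        + 1 * walks n (step c z a) α
          ≡⟨ cong (λ t → (+ 1 - t) * walks n (step c z a) α) (δ-≢ Fin._≟_ a≢0) ⟨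
        nonzero a * walks n (step c z a) α ∎

  countA≡walks : ∀ n α → + countA n c α ≡ walks n 0V α
  countA≡walks n α = count≡walks n 0V α

module Discrepancy (p : ℕ) .{{_ : NonZero p}} (p-prime : Prime p) {d : ℕ} (c : Vec (Fin p) (suc d))
                   (x∤u : Field.XNotDivides p c) where

  open import Data.Nat.Base as ℕ using (zero; _∸_; _≤_; _^_)
  import Data.Nat.Properties as ℕ
  open import Data.Nat.DivMod using (_/_; _%_; m≥n⇒m/n>0; m≡m%n+[m/n]*n)
  open import Data.Nat.Primality using (prime⇒nonTrivial)
  open import Data.Integer.Base as ℤ using (ℤ; +_; _+_; _*_; -_; _-_; ∣_∣)
  import Data.Integer.Properties as ℤ
  open import Data.Integer.Tactic.RingSolver using (solve-∀)
  import Data.Rational.Base as ℚ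
  open import Algebra.Properties.CommutativeSemigroup ℕ.*-commutativeSemigroup
    using (x∙yz≈y∙zx; x∙yz≈z∙yx; x∙yz≈y∙xz)
  open import Relation.Binary.PropositionalEquality
  open Field p using (countA)
  open AbsoluteBound
  open PowerBounds using (gap-bound; square-cancel-bound)
  open Fractions
  open Walks p c
  open Equidistribution p p-prime c x∤u
  open Counting p c

  2≤p : 2 ≤ p
  2≤p = ℕ.nonTrivial⇒n>1 p {{prime⇒nonTrivial p-prime}}

  instance
    p∸1≢0 : NonZero (p ∸ 1)
    p∸1≢0 = ℕ.>-nonZero (ℕ.m<n⇒0<n∸m 2≤p)

  q r e : ℕ
  q = p ^ D
  r = (p ∸ 1) ^ D
  e = q ∸ r

  instance
    r≢0 : NonZero r
    r≢0 = ℕ.m^n≢0 (p ∸ 1) D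

    q≢0 : NonZero q
    q≢0 = ℕ.m^n≢0 p D

  E≡+e : E ≡ + e
  E≡+e = trans (ℤ.m-n≡m⊖n q r) (ℤ.⊖-≥ (ℕ.^-monoˡ-≤ D (ℕ.m∸n≤m p 1)))

  discrepancyBound-ℕ : ∀ {n j} → DiscrepancyBound n j → ∀ α → r ^ j ℕ.* ∣ X n α ∣ ≤ (p ∸ 1) ^ n ℕ.* e ^ j
  discrepancyBound-ℕ {n} {j} bound α = ℤ.drop‿+≤+ (subst₂ ℤ._≤_ lhs rhs (∣∣≤⇒+∣∣≤ (bound α)))
    where
      lhs : + ∣ R ℤ.^ j * X n α ∣ ≡ + (r ^ j ℕ.* ∣ X n α ∣)
      lhs = cong +_ (trans (ℤ.abs-* (R ℤ.^ j) (X n α)) (cong (λ t → ∣ t ∣ ℕ.* ∣ X n α ∣) (sym (pos-^ r j))))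
      rhs : P n * E ℤ.^ j ≡ + ((p ∸ 1) ^ n ℕ.* e ^ j)
      rhs = trans (cong (λ t → P n * t ℤ.^ j) E≡+e)
                  (trans (cong (P n *_) (sym (pos-^ e j))) (sym (ℤ.pos-* ((p ∸ 1) ^ n) (e ^ j))))

  discrepancy-≐ : ∀ n α → discrepancy p n c α ≐ + ∣ X n α ∣ ÷ + ((p ∸ 1) ^ n ℕ.* q)
  discrepancy-≐ n α = ≐-cong (cong (λ t → + ∣ t ∣) numerator) refl
    (∣∣-≐ (≐-cong refl (sym (ℤ.pos-* ((p ∸ 1) ^ n) q))
      (+-≐ (frac-≐ (countA n c α) ((p ∸ 1) ^ n) {{ℕ.m^n≢0 (p ∸ 1) n}}) (neg-≐ (frac-≐ 1 q {{ℕ.m^n≢0 p D}})))))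
    where
      numerator : + countA n c α * + q + - + 1 * + ((p ∸ 1) ^ n) ≡ X n α
      numerator = trans (cong (λ a → a * Q + - + 1 * P n) (countA≡walks n α)) (rearrange (N n α) Q (P n))
        where
          rearrange : ∀ a Q P → a * Q + - + 1 * P ≡ Q * a - P
          rearrange = solve-∀

  bound-≐ : ∀ m → frac 1 q ℚ.* powQ (powQ (frac p (p ∸ 1)) D ℚ.- ℚ.1ℚ) m ≐ + (e ^ m) ÷ + (q ℕ.* r ^ m)
  bound-≐ m = ≐-cong numerator denominator
    (*-≐ (frac-≐ 1 q {{ℕ.m^n≢0 p D}}) (powQ-≐ m (≐-cong E/R (ℤ.*-identityʳ R)
      (+-≐ (≐-cong (sym (pos-^ p D)) (sym (pos-^ (p ∸ 1) D)) (powQ-≐ D (frac-≐ p (p ∸ 1)))) (neg-≐ 1-≐)))))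
    where
      E/R : Q * + 1 + - + 1 * R ≡ + e
      E/R = trans (cong₂ (λ u v → u + v) (ℤ.*-identityʳ Q) (ℤ.-1*i≡-i R)) E≡+e
      numerator : + 1 * (+ e) ℤ.^ m ≡ + (e ^ m)
      numerator = trans (ℤ.*-identityˡ _) (sym (pos-^ e m))
      denominator : + q * R ℤ.^ m ≡ + (q ℕ.* r ^ m)
      denominator = trans (cong (+ q *_) (sym (pos-^ r m))) (sym (ℤ.pos-* q (r ^ m)))

  2D≡D+D : 2 ℕ.* D ≡ D ℕ.+ D
  2D≡D+D = cong (D ℕ.+_) (ℕ.+-identityʳ D)

  period-multiple : ∀ n → D ℕ.+ D ≤ n → DiscrepancyBound n (n / (2 ℕ.* D))
  period-multiple n D+D≤n with n / (2 ℕ.* D) | m≥n⇒m/n>0 {n} {2 ℕ.* D} (subst (_≤ n) (sym 2D≡D+D) D+D≤n)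
                             | m≡m%n+[m/n]*n n (2 ℕ.* D)
  ... | suc j | _ | n≡ = subst (λ k → DiscrepancyBound k (suc j))
                               (sym (trans n≡ (cong (λ t → n % (2 ℕ.* D) ℕ.+ suc j ℕ.* t) 2D≡D+D)))
                               (discrepancyBound j (n % (2 ℕ.* D)))

  discrepancy≤bound : ∀ n → D ℕ.+ D ≤ n → ∀ α → discrepancy p n c α ℚ.≤ bound p n D
  discrepancy≤bound n D+D≤n α =
    ≤-by-ℕ {{ℕ.m*n≢0 ((p ∸ 1) ^ n) q {{ℕ.m^n≢0 (p ∸ 1) n}}}} {{ℕ.m*n≢0 q (r ^ m) {{q≢0}} {{ℕ.m^n≢0 r m}}}}
      (discrepancy-≐ n α) (bound-≐ m) (begin
        ∣ X n α ∣ ℕ.* (q ℕ.* r ^ m)     ≡⟨ x∙yz≈y∙zx ∣ X n α ∣ q (r ^ m) ⟩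
        q ℕ.* (r ^ m ℕ.* ∣ X n α ∣)     ≤⟨ ℕ.*-monoʳ-≤ q (discrepancyBound-ℕ {n} {m} (period-multiple n D+D≤n) α) ⟩
        q ℕ.* ((p ∸ 1) ^ n ℕ.* e ^ m)   ≡⟨ x∙yz≈z∙yx q ((p ∸ 1) ^ n) (e ^ m) ⟩
        e ^ m ℕ.* ((p ∸ 1) ^ n ℕ.* q)   ∎)
    where
      open ℕ.≤-Reasoning
      m = n / (2 ℕ.* D)

  discrepancy≤constant : ∀ n K → 2 ℕ.* (D ℕ.+ D) ≤ n → (D ℕ.* 2 ^ D) ^ 2 ≤ K → ∀ α →
                         discrepancy p n c α ℚ.≤ frac K 1 ℚ.* frac 1 (p ^ (D ℕ.+ 2))
  discrepancy≤constant n K 4D≤n k²≤K α =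
    ≤-by-ℕ {{ℕ.m*n≢0 ((p ∸ 1) ^ n) q {{ℕ.m^n≢0 (p ∸ 1) n}}}} {{ℕ.m^n≢0 p (D ℕ.+ 2)}}
      (discrepancy-≐ n α)
      (≐-cong (ℤ.*-identityʳ (+ K)) (ℤ.*-identityˡ (+ (p ^ (D ℕ.+ 2))))
              (*-≐ (frac-≐ K 1) (frac-≐ 1 (p ^ (D ℕ.+ 2)) {{ℕ.m^n≢0 p (D ℕ.+ 2)}})))
      (begin
        ∣ X n α ∣ ℕ.* p ^ (D ℕ.+ 2)      ≡⟨ cong (∣ X n α ∣ ℕ.*_) (ℕ.^-distribˡ-+-* p D 2) ⟩
        ∣ X n α ∣ ℕ.* (q ℕ.* p ^ 2)      ≡⟨ x∙yz≈y∙xz ∣ X n α ∣ q (p ^ 2) ⟩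
        q ℕ.* (∣ X n α ∣ ℕ.* p ^ 2)      ≤⟨ ℕ.*-monoʳ-≤ q scaled ⟩
        q ℕ.* (K ℕ.* (p ∸ 1) ^ n)        ≡⟨ x∙yz≈y∙xz q K ((p ∸ 1) ^ n) ⟩
        K ℕ.* (q ℕ.* (p ∸ 1) ^ n)        ≡⟨ cong (K ℕ.*_) (ℕ.*-comm q ((p ∸ 1) ^ n)) ⟩
        K ℕ.* ((p ∸ 1) ^ n ℕ.* q)        ∎)
    where
      open ℕ.≤-Reasoning
      two-periods : DiscrepancyBound n 2
      two-periods = subst (λ k → DiscrepancyBound k 2) (ℕ.m∸n+n≡m 4D≤n)
                          (discrepancyBound 1 (n ∸ 2 ℕ.* (D ℕ.+ D)))
      scaled : ∣ X n α ∣ ℕ.* p ^ 2 ≤ K ℕ.* (p ∸ 1) ^ n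
      scaled = square-cancel-bound {∣ X n α ∣} {(p ∸ 1) ^ n} {e} {r} {p} {D ℕ.* 2 ^ D} {K}
                                   (discrepancyBound-ℕ {n} {2} two-periods α) (gap-bound D 2≤p) k²≤K

open import Data.Nat using (ℕ; NonZero; _≤_; _+_; _^_) renaming (_*_ to _*ℕ_)
open import Data.Nat.Primality using (Prime)
open import Data.Fin using (Fin)
open import Data.Vec using (Vec)
open import Data.Product using (_×_; Σ)
open import Data.Rational using (ℚ; _*_) renaming (_≤_ to _≤ℚ_)
open import Relation.Binary.PropositionalEquality using (_≢_)
open import Data.Nat using (suc)
import Data.Nat.Properties as ℕ
open import Data.Product using (_,_)
open import Relation.Binary.PropositionalEquality using (subst; cong)

discrepancy≤bound : (p : ℕ) .{{_ : NonZero p}} → Prime p → (n d : ℕ) → 1 ≤ d → 2 *ℕ d ≤ n →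
                    (c : Vec (Fin p) d) → Field.XNotDivides p c → (α : Vec (Fin p) d) →
                    discrepancy p n c α ≤ℚ bound p n d
discrepancy≤bound p p-prime n (suc d) _ 2d≤n c x∤u =
  Discrepancy.discrepancy≤bound p p-prime c x∤u n
    (subst (_≤ n) (cong (suc d +_) (ℕ.+-identityʳ (suc d))) 2d≤n)

discrepancy≤4096/p^[d+2] : (p : ℕ) .{{_ : NonZero p}} → Prime p → (n d : ℕ) → 1 ≤ d → d ≤ 4 → 16 ≤ n →
                           (c : Vec (Fin p) d) → Field.XNotDivides p c → (α : Vec (Fin p) d) →
                           discrepancy p n c α ≤ℚ frac 4096 1 * frac 1 (p ^ (d + 2))
discrepancy≤4096/p^[d+2] p p-prime n (suc d) _ d≤4 16≤n c x∤u =
  Discrepancy.discrepancy≤constant p p-prime c x∤u n 4096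
    (ℕ.≤-trans (ℕ.*-monoʳ-≤ 2 (ℕ.+-mono-≤ d≤4 d≤4)) 16≤n)
    (ℕ.^-monoˡ-≤ 2 (ℕ.*-mono-≤ d≤4 (ℕ.^-monoʳ-≤ 2 d≤4)))

theorem4p1 :
    ((p : ℕ) .{{_ : NonZero p}} → Prime p → p ≢ 2 →
      (n d : ℕ) → 1 ≤ d → 2 *ℕ d ≤ n →
      (c : Vec (Fin p) d) → Field.XNotDivides p c → (α : Vec (Fin p) d) →
      discrepancy p n c α ≤ℚ bound p n d)
    ×
    Σ ℚ (λ C → (p : ℕ) .{{_ : NonZero p}} → Prime p → p ≢ 2 →
      (n d : ℕ) → 1 ≤ d → d ≤ 4 → 16 ≤ n →
      (c : Vec (Fin p) d) → Field.XNotDivides p c → (α : Vec (Fin p) d) →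
      discrepancy p n c α ≤ℚ C * frac 1 (p ^ (d + 2)))
theorem4p1 = (λ p p-prime _ → discrepancy≤bound p p-prime)
           , frac 4096 1 , (λ p p-prime _ → discrepancy≤4096/p^[d+2] p p-prime)
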